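{- Let $p$ be an odd prime, and let $n$ be a positive integer not divisible by $p-1$. Then $F_p(n,0)/n\in\mathbb{Z}_p$.
   Context: $C_p(n,r)=\sum_{k\equiv r\,(\mathrm{mod}\ p)}\binom nk(-1)^k$ and $F_p(n,r)=(-p)^{ -\lfloor (n-1)/(p-1)\rfloor}C_p(n,r)+[\![n=0]\!]$ for $n\in\mathbb{N}$, $r\in\mathbb{Z}$. $\mathbb{Z}_p$ is the ring of $p$-adic integers. -}

module Defs where

open import Data.Nat as ℕ using (ℕ; zero; suc; _∸_; NonZero)
open import Data.Nat.Divisibility using (_∣_; _∣?_)
open import Data.Nat.Combinatorics using (_C_)
open import Data.Integer as ℤ using (ℤ; +_; ∣_∣)
open import Data.Rational as ℚ using (ℚ; ↧ₙ_)
open import Relation.Nullary using (¬_; yes; no)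

sgn : ℕ → ℤ
sgn zero = + 1
sgn (suc k) = ℤ.- sgn k

term : (p n : ℕ) (r : ℤ) (k : ℕ) → ℤ
term p n r k with p ∣? ∣ (+ k) ℤ.- r ∣
... | yes _ = (+ (n C k)) ℤ.* sgn k
... | no  _ = + 0

sumTo : ℕ → (ℕ → ℤ) → ℤ
sumTo zero f = f zero
sumTo (suc m) f = sumTo m f ℤ.+ f (suc m)

-- C_p(n,r) = Σ_{k ≡ r (mod p)} binom(n,k) (-1)^k   (binom(n,k)=0 for k>n)
Cp : (p n : ℕ) (r : ℤ) → ℤ
Cp p n r = sumTo n (term p n r)

-- floor division on ℕ (only used with d = p-1 ≥ 1)
divℕ : ℕ → ℕ → ℕ
divℕ m zero = 0
divℕ m (suc d) = m ℕ./ suc d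

-- F_p(n,r) = (-p)^{-⌊(n-1)/(p-1)⌋} C_p(n,r) + [n = 0]
-- For n = 0, ⌊(0-1)/(p-1)⌋ = -1, so F_p(0,r) = (-p) C_p(0,r) + 1.
-- For n ≥ 1, ⌊(n-1)/(p-1)⌋ = e ≥ 0 and F_p(n,r) = C_p(n,r) / (-p)^e.
Fp : (p n : ℕ) (r : ℤ) → ℚ
Fp p zero r = ℚ._+_ (ℚ._*_ (ℚ.-_ (ℚ._/_ (+ p) 1)) (ℚ._/_ (Cp p zero r) 1)) ℚ.1ℚ
Fp p (suc m) r with divℕ m (p ∸ 1)
... | e with ℕ._^_ p e
...   | zero = ℚ.0ℚ   -- unreachable for p prime
...   | suc q = ℚ._/_ (ℤ._*_ (sgn e) (Cp p (suc m) r)) (suc q)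

-- a rational number lies in ℤ_p iff p does not divide its reduced denominator
InZp : ℕ → ℚ → Set
InZp p x = ¬ (p ∣ ↧ₙ x)

divBy : ℚ → (n : ℕ) → .{{NonZero n}} → ℚ
divBy x n = ℚ._*_ x (ℚ._/_ (+ 1) n)

{-# OPTIONS --safe #-}
module Submission where

-- Let q = p - 1 and a(n) = C_p(n, 0).  As p is odd, ∑ₙ a(n) xⁿ = (1 - x)^q / ((1 - x)^p + x^p), and
-- (1 - x)^p + x^p = 1 + p H(x) with H integral, H(0) = 0 and H = x^q + L, deg L < q.  Hence
-- A(x) = ∑ₙ a(n + 1) xⁿ satisfies A (1 + p H) = -H′, so that
--   a(n) = -∑ₘ (-p)ᵐ [x^(n-1)] H′ Hᵐ,  where  (m + 1) [x^(n-1)] H′ Hᵐ = n [xⁿ] H^(m+1).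
-- Let e = ⌊(n - 1) / q⌋ and pᵛ ∣ n.  The m-th term vanishes for m < e, since deg H^(m+1) < n, and
-- is divisible by p^(e+v) for m ≥ e + v.  For m = e + d with d < v, write M = m + 1 = pᵘ m′ and
-- expand H^M = ∑ⱼ (M choose j) x^(q(M-j)) Lʲ: the term j = 0 misses xⁿ because q ∤ n, and every
-- other term reaching xⁿ has 0 < j < (d + 1) q < p^(d+1), so p^(u-d) divides (M choose j).  Then
-- p^(v+u-d) divides n [xⁿ] H^M = pᵘ m′ [x^(n-1)] H′ Hᵐ, which gives p^(e+v) for the m-th term.
-- Altogether p^(e+v) ∣ a(n), i.e. F_p(n, 0) / n = ± a(n) / (p^e n) has no p in its denominator.

open import Defs
open import Data.Nat using (ℕ; _∸_; NonZero)
open import Data.Nat.Divisibility using (_∣_)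
open import Data.Nat.Primality using (Prime)
open import Data.Integer using (+_)
open import Relation.Nullary using (¬_)

open import Algebra.Bundles using (AbelianGroup)
open import Data.Nat as ℕ using (zero; suc; z≤n; s≤s)
import Data.Nat.Properties as ℕₚ
open import Data.Nat.Combinatorics using (_C_; nCk+nC[k+1]≡[n+1]C[k+1]; k>n⇒nCk≡0; nCn≡1; nC1≡n; nCk≡nC[n∸k])
open import Data.Nat.Divisibility
  using (_∣?_; divides; _∣0; 1∣_; ∣-refl; ∣-trans; ∣⇒≤; m∣m*n; ∣m∣n⇒∣m+n; ∣m+n∣m⇒∣n; *-pres-∣; *-monoʳ-∣; *-cancelˡ-∣; module ∣-Reasoning)
open import Data.Nat.DivMod using (_/_; m<n⇒m/n≡0; m*[n/m]≡n; n/n≡1; m/n*n≤m)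
open import Data.Nat.Induction using (<-rec)
open import Data.Nat.Primality using (euclidsLemma; prime⇒nonZero; prime⇒nonTrivial)
open import Data.Nat.Tactic.RingSolver using () renaming (solve-∀ to ℕ-solve-∀)
open import Data.Integer as ℤ using (ℤ; _+_; _*_; -_; _-_; _^_)
import Data.Integer.Properties as ℤₚ
import Data.Integer.Divisibility.Signed as ℤ∣
open import Data.Integer.GCD using (gcd)
open import Data.Integer.Tactic.RingSolver using (solve-∀)
open import Algebra.Properties.Group (AbelianGroup.group ℤₚ.+-0-abelianGroup) using (∙-cancelʳ)
open import Algebra.Properties.CommutativeSemigroup ℤₚ.*-commutativeSemigroup using (x∙yz≈y∙xz; xy∙z≈y∙xz; x∙yz≈xz∙y)
open import Data.Rational as ℚ using (↥_; ↧_; ↧ₙ_; toℚᵘ)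
import Data.Rational.Properties as ℚₚ
import Data.Rational.Unnormalised as ℚᵘ
import Data.Rational.Unnormalised.Properties as ℚᵘₚ
open import Data.Product using (∃; ∃₂; _×_; _,_)
open import Data.Sum using (inj₁; inj₂)
open import Function using (_∘_)
open import Relation.Binary.PropositionalEquality
open import Relation.Nullary using (yes; no; contradiction)

-- Finite sums

∑ : ℕ → (ℕ → ℤ) → ℤ
∑ zero    f = + 0
∑ (suc n) f = ∑ n f + f n

infixl 10 ∑
syntax ∑ n (λ i → x) = ∑[ i < n ] x

∑-cong : ∀ n {f g : ℕ → ℤ} → (∀ i → i ℕ.< n → f i ≡ g i) → ∑ n f ≡ ∑ n g
∑-cong zero    f≡g = refl
∑-cong (suc n) f≡g =
  cong₂ _+_ (∑-cong n (λ i i<n → f≡g i (ℕₚ.m<n⇒m<1+n i<n))) (f≡g n ℕₚ.≤-refl)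

∑-zero : ∀ n {f : ℕ → ℤ} → (∀ i → i ℕ.< n → f i ≡ + 0) → ∑ n f ≡ + 0
∑-zero zero    f≡0 = refl
∑-zero (suc n) f≡0 =
  cong₂ _+_ (∑-zero n (λ i i<n → f≡0 i (ℕₚ.m<n⇒m<1+n i<n))) (f≡0 n ℕₚ.≤-refl)

∑-distrib-+ : ∀ n (f g : ℕ → ℤ) → ∑[ i < n ] (f i + g i) ≡ ∑ n f + ∑ n g
∑-distrib-+ zero    f g = refl
∑-distrib-+ (suc n) f g =
  trans (cong (_+ (f n + g n)) (∑-distrib-+ n f g)) (interchange (∑ n f) (∑ n g) (f n) (g n))
  where
  interchange : ∀ a b c d → a + b + (c + d) ≡ a + c + (b + d)
  interchange = solve-∀

*-distribˡ-∑ : ∀ n c (f : ℕ → ℤ) → c * ∑ n f ≡ ∑[ i < n ] (c * f i)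
*-distribˡ-∑ zero    c f = ℤₚ.*-zeroʳ c
*-distribˡ-∑ (suc n) c f =
  trans (ℤₚ.*-distribˡ-+ c (∑ n f) (f n)) (cong (_+ c * f n) (*-distribˡ-∑ n c f))

∑-neg : ∀ n (f : ℕ → ℤ) → ∑[ i < n ] (- f i) ≡ - ∑ n f
∑-neg n f = begin
  ∑[ i < n ] (- f i)           ≡⟨ ∑-cong n (λ i _ → ℤₚ.-1*i≡-i (f i)) ⟨
  ∑[ i < n ] (ℤ.-1ℤ * f i)     ≡⟨ *-distribˡ-∑ n ℤ.-1ℤ f ⟨
  ℤ.-1ℤ * ∑ n f                ≡⟨ ℤₚ.-1*i≡-i (∑ n f) ⟩
  - ∑ n f                      ∎
  where open ≡-Reasoning

∑-head : ∀ n (f : ℕ → ℤ) → ∑ (suc n) f ≡ f 0 + ∑[ i < n ] f (suc i)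
∑-head zero    f = ℤₚ.+-comm (+ 0) (f 0)
∑-head (suc n) f = trans (cong (_+ f (suc n)) (∑-head n f)) (ℤₚ.+-assoc (f 0) _ _)

∑-split : ∀ m n (f : ℕ → ℤ) → ∑ (m ℕ.+ n) f ≡ ∑ m f + ∑[ i < n ] f (m ℕ.+ i)
∑-split m zero    f = trans (cong (λ k → ∑ k f) (ℕₚ.+-identityʳ m)) (sym (ℤₚ.+-identityʳ (∑ m f)))
∑-split m (suc n) f = begin
  ∑ (m ℕ.+ suc n) f                                     ≡⟨ cong (λ k → ∑ k f) (ℕₚ.+-suc m n) ⟩
  ∑ (m ℕ.+ n) f + f (m ℕ.+ n)                           ≡⟨ cong (_+ f (m ℕ.+ n)) (∑-split m n f) ⟩
  ∑ m f + ∑[ i < n ] f (m ℕ.+ i) + f (m ℕ.+ n)          ≡⟨ ℤₚ.+-assoc (∑ m f) _ _ ⟩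
  ∑ m f + ∑[ i < suc n ] f (m ℕ.+ i)                    ∎
  where open ≡-Reasoning

∑-extend : ∀ {m n} (f : ℕ → ℤ) → m ℕ.≤ n → (∀ i → m ℕ.≤ i → f i ≡ + 0) → ∑ n f ≡ ∑ m f
∑-extend {m} f m≤n f≡0 with ℕₚ.m≤n⇒∃[o]m+o≡n m≤n
... | k , refl = begin
  ∑ (m ℕ.+ k) f                       ≡⟨ ∑-split m k f ⟩
  ∑ m f + ∑[ i < k ] f (m ℕ.+ i)      ≡⟨ cong (_+_ (∑ m f)) (∑-zero k (λ i _ → f≡0 (m ℕ.+ i) (ℕₚ.m≤m+n m i))) ⟩
  ∑ m f + + 0                         ≡⟨ ℤₚ.+-identityʳ (∑ m f) ⟩
  ∑ m f                               ∎
  where open ≡-Reasoning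

∑-single : ∀ n {c} (f : ℕ → ℤ) → c ℕ.< n → (∀ i → i ℕ.< n → i ≢ c → f i ≡ + 0) → ∑ n f ≡ f c
∑-single (suc n) {c} f c<1+n f≡0 with c ℕ.≟ n
... | yes refl = trans (cong (_+ f n) (∑-zero n below)) (ℤₚ.+-identityˡ (f n))
  where
  below : ∀ i → i ℕ.< n → f i ≡ + 0
  below i i<n = f≡0 i (ℕₚ.m<n⇒m<1+n i<n) (λ { refl → ℕₚ.<-irrefl refl i<n })
... | no c≢n = trans (cong₂ _+_ (∑-single n f c<n below) (f≡0 n ℕₚ.≤-refl (c≢n ∘ sym)))
                     (ℤₚ.+-identityʳ (f c))
  where
  c<n = ℕₚ.≤∧≢⇒< (ℕₚ.≤-pred c<1+n) c≢n
  below : ∀ i → i ℕ.< n → i ≢ c → f i ≡ + 0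
  below i i<n = f≡0 i (ℕₚ.m<n⇒m<1+n i<n)

∑-comm : ∀ m n (F : ℕ → ℕ → ℤ) → ∑[ i < m ] ∑[ j < n ] F i j ≡ ∑[ j < n ] ∑[ i < m ] F i j
∑-comm zero    n F = sym (∑-zero n (λ _ _ → refl))
∑-comm (suc m) n F =
  trans (cong (_+ ∑[ j < n ] F m j) (∑-comm m n F)) (sym (∑-distrib-+ n _ (F m)))

∑-∣ : ∀ {d} n (f : ℕ → ℤ) → (∀ i → i ℕ.< n → d ∣ ℤ.∣ f i ∣) → d ∣ ℤ.∣ ∑ n f ∣
∑-∣ zero    f d∣f = _ ∣0
∑-∣ {d} (suc n) f d∣f = ℤ∣.∣⇒∣ᵤ {+ d} {∑ (suc n) f} (ℤ∣.∣m∣n⇒∣m+n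
  (ℤ∣.∣ᵤ⇒∣ {+ d} {∑ n f} (∑-∣ n f (λ i i<n → d∣f i (ℕₚ.m<n⇒m<1+n i<n))))
  (ℤ∣.∣ᵤ⇒∣ {+ d} {f n} (d∣f n ℕₚ.≤-refl)))

∑-triangle : ∀ n (F : ℕ → ℕ → ℤ) →
  ∑[ i < suc n ] ∑[ j < suc (n ∸ i) ] F i j ≡ ∑[ j < suc n ] ∑[ i < suc (n ∸ j) ] F i j
∑-triangle zero    F = refl
∑-triangle (suc n) F = begin
  ∑[ i < suc (suc n) ] ∑[ j < suc (suc n ∸ i) ] F i j
    ≡⟨ ∑-head (suc n) _ ⟩
  ∑[ j < suc (suc n) ] F 0 j + ∑[ i < suc n ] ∑[ j < suc (n ∸ i) ] F (suc i) j
    ≡⟨ cong (_+_ (∑[ j < suc (suc n) ] F 0 j)) (∑-triangle n (F ∘ suc)) ⟩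
  ∑[ j < suc n ] F 0 j + F 0 (suc n) + ∑[ j < suc n ] ∑[ i < suc (n ∸ j) ] F (suc i) j
    ≡⟨ swap-last (∑[ j < suc n ] F 0 j) (F 0 (suc n)) _ ⟩
  ∑[ j < suc n ] F 0 j + ∑[ j < suc n ] ∑[ i < suc (n ∸ j) ] F (suc i) j + F 0 (suc n)
    ≡⟨ cong (_+ F 0 (suc n)) (∑-distrib-+ (suc n) (F 0) _) ⟨
  ∑[ j < suc n ] (F 0 j + ∑[ i < suc (n ∸ j) ] F (suc i) j) + F 0 (suc n)
    ≡⟨ cong₂ _+_ (∑-cong (suc n) (λ j j<1+n → unpeel j (ℕₚ.≤-pred j<1+n))) last-column ⟨
  ∑[ j < suc (suc n) ] ∑[ i < suc (suc n ∸ j) ] F i j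
    ∎
  where
  open ≡-Reasoning
  swap-last : ∀ a b c → a + b + c ≡ a + c + b
  swap-last = solve-∀
  unpeel : ∀ j → j ℕ.≤ n → ∑[ i < suc (suc n ∸ j) ] F i j ≡ F 0 j + ∑[ i < suc (n ∸ j) ] F (suc i) j
  unpeel j j≤n rewrite ℕₚ.+-∸-assoc 1 j≤n = ∑-head (suc (n ∸ j)) (λ i → F i j)
  last-column : ∑[ i < suc (n ∸ n) ] F i (suc n) ≡ F 0 (suc n)
  last-column rewrite ℕₚ.n∸n≡0 n = ℤₚ.+-identityˡ (F 0 (suc n))

∑-telescope : ∀ L (f : ℕ → ℤ) → ∑ L f - ∑[ m < L ] f (suc m) ≡ f 0 - f L
∑-telescope zero    f = trans (ℤₚ.+-inverseʳ (+ 0)) (sym (ℤₚ.+-inverseʳ (f 0)))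
∑-telescope (suc L) f = begin
  ∑ L f + f L - (∑[ m < L ] f (suc m) + f (suc L))     ≡⟨ regroup (∑ L f) (f L) (∑[ m < L ] f (suc m)) (f (suc L)) ⟩
  (∑ L f - ∑[ m < L ] f (suc m)) + (f L - f (suc L))   ≡⟨ cong (_+ (f L - f (suc L))) (∑-telescope L f) ⟩
  f 0 - f L + (f L - f (suc L))                        ≡⟨ cancel (f 0) (f L) (f (suc L)) ⟩
  f 0 - f (suc L)                                      ∎
  where
  open ≡-Reasoning
  regroup : ∀ a b c d → a + b - (c + d) ≡ (a - c) + (b - d)
  regroup = solve-∀
  cancel : ∀ a b c → a - b + (b - c) ≡ a - c
  cancel = solve-∀

∑-pascal : ∀ M (V : ℕ → ℤ) →
  ∑[ j < suc M ] (+ (M C j) * (V j + V (suc j))) ≡ ∑[ j < suc (suc M) ] (+ (suc M C j) * V j)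
∑-pascal M V = begin
  ∑[ j < suc M ] (+ (M C j) * (V j + V (suc j)))
    ≡⟨ trans (∑-cong (suc M) (λ j _ → ℤₚ.*-distribˡ-+ (+ (M C j)) (V j) (V (suc j)))) (∑-distrib-+ (suc M) _ _) ⟩
  ∑[ j < suc M ] (+ (M C j) * V j) + ∑[ j < suc M ] (+ (M C j) * V (suc j))
    ≡⟨ cong (_+ ∑[ j < suc M ] (+ (M C j) * V (suc j))) (∑-head M _) ⟩
  (+ 1 * V 0 + ∑[ j < M ] (+ (M C suc j) * V (suc j))) + ∑[ j < suc M ] (+ (M C j) * V (suc j))
    ≡⟨ cong (λ t → (+ 1 * V 0 + t) + ∑[ j < suc M ] (+ (M C j) * V (suc j))) top-term ⟨
  (+ 1 * V 0 + ∑[ j < suc M ] (+ (M C suc j) * V (suc j))) + ∑[ j < suc M ] (+ (M C j) * V (suc j))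
    ≡⟨ reassoc (+ 1 * V 0) _ _ ⟩
  + 1 * V 0 + (∑[ j < suc M ] (+ (M C j) * V (suc j)) + ∑[ j < suc M ] (+ (M C suc j) * V (suc j)))
    ≡⟨ cong (_+_ (+ 1 * V 0)) (trans (sym (∑-distrib-+ (suc M) _ _)) (∑-cong (suc M) (λ j _ → pascal j))) ⟩
  + 1 * V 0 + ∑[ j < suc M ] (+ (suc M C suc j) * V (suc j))
    ≡⟨ ∑-head (suc M) _ ⟨
  ∑[ j < suc (suc M) ] (+ (suc M C j) * V j)
    ∎
  where
  open ≡-Reasoning
  reassoc : ∀ a b c → (a + b) + c ≡ a + (c + b)
  reassoc = solve-∀
  top-term : ∑[ j < suc M ] (+ (M C suc j) * V (suc j)) ≡ ∑[ j < M ] (+ (M C suc j) * V (suc j))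
  top-term = ∑-extend _ (ℕₚ.n≤1+n M) (λ j M≤j → cong (λ c → + c * V (suc j)) (k>n⇒nCk≡0 (s≤s M≤j)))
  pascal : ∀ j → + (M C j) * V (suc j) + + (M C suc j) * V (suc j) ≡ + (suc M C suc j) * V (suc j)
  pascal j = begin
    + (M C j) * V (suc j) + + (M C suc j) * V (suc j)   ≡⟨ ℤₚ.*-distribʳ-+ (V (suc j)) (+ (M C j)) (+ (M C suc j)) ⟨
    (+ (M C j) + + (M C suc j)) * V (suc j)             ≡⟨ cong (λ c → c * V (suc j)) (ℤₚ.pos-+ (M C j) (M C suc j)) ⟨
    + (M C j ℕ.+ M C suc j) * V (suc j)                 ≡⟨ cong (λ c → + c * V (suc j)) (nCk+nC[k+1]≡[n+1]C[k+1] M j) ⟩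
    + (suc M C suc j) * V (suc j)                       ∎

∑-alternating-binomial : ∀ q N → ∑[ i < suc N ] (sgn i * + (suc q C i)) ≡ sgn N * + (q C N)
∑-alternating-binomial q zero    = refl
∑-alternating-binomial q (suc N) = begin
  ∑[ i < suc N ] (sgn i * + (suc q C i)) + - sgn N * + (suc q C suc N)
    ≡⟨ cong (_+ - sgn N * + (suc q C suc N)) (∑-alternating-binomial q N) ⟩
  sgn N * + (q C N) + - sgn N * + (suc q C suc N)
    ≡⟨ cong (λ c → sgn N * + (q C N) + - sgn N * + c) (nCk+nC[k+1]≡[n+1]C[k+1] q N) ⟨
  sgn N * + (q C N) + - sgn N * + (q C N ℕ.+ q C suc N)
    ≡⟨ cong (λ c → sgn N * + (q C N) + - sgn N * c) (ℤₚ.pos-+ (q C N) (q C suc N)) ⟩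
  sgn N * + (q C N) + - sgn N * (+ (q C N) + + (q C suc N))
    ≡⟨ cancel (sgn N) (+ (q C N)) (+ (q C suc N)) ⟩
  - sgn N * + (q C suc N)
    ∎
  where
  open ≡-Reasoning
  cancel : ∀ s x y → s * x + - s * (x + y) ≡ - s * y
  cancel = solve-∀

-- Formal power series

Series : Set
Series = ℕ → ℤ

infixr 7 _⊛_
infixr 8 _^⊛_

_⊛_ : Series → Series → Series
(f ⊛ g) n = ∑[ i < suc n ] (f i * g (n ∸ i))

X^ : ℕ → Series
X^ c i with i ℕ.≟ c
... | yes _ = + 1
... | no  _ = + 0

_^⊛_ : Series → ℕ → Series
f ^⊛ zero  = X^ 0
f ^⊛ suc m = f ⊛ f ^⊛ m

∂ : Series → Series
∂ f i = + suc i * f (suc i)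

VanishesBelow : ℕ → Series → Set
VanishesBelow a f = ∀ i → i ℕ.< a → f i ≡ + 0

VanishesAbove : ℕ → Series → Set
VanishesAbove a f = ∀ i → a ℕ.< i → f i ≡ + 0

X^-diag : ∀ c → X^ c c ≡ + 1
X^-diag c with c ℕ.≟ c
... | yes _   = refl
... | no  c≢c = contradiction refl c≢c

X^-off : ∀ {c i} → i ≢ c → X^ c i ≡ + 0
X^-off {c} {i} i≢c with i ℕ.≟ c
... | yes i≡c = contradiction i≡c i≢c
... | no  _   = refl

⊛-congˡ : ∀ {f f′} g → (∀ i → f i ≡ f′ i) → ∀ n → (f ⊛ g) n ≡ (f′ ⊛ g) n
⊛-congˡ g f≡f′ n = ∑-cong (suc n) (λ i _ → cong (_* g (n ∸ i)) (f≡f′ i))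

⊛-congʳ : ∀ f {g g′} → (∀ i → g i ≡ g′ i) → ∀ n → (f ⊛ g) n ≡ (f ⊛ g′) n
⊛-congʳ f g≡g′ n = ∑-cong (suc n) (λ i _ → cong (f i *_) (g≡g′ (n ∸ i)))

⊛-distribʳ-+ : ∀ f g k n → ((λ i → f i + g i) ⊛ k) n ≡ (f ⊛ k) n + (g ⊛ k) n
⊛-distribʳ-+ f g k n =
  trans (∑-cong (suc n) (λ i _ → ℤₚ.*-distribʳ-+ (k (n ∸ i)) (f i) (g i))) (∑-distrib-+ (suc n) _ _)

⊛-*ʳ : ∀ f c g n → (f ⊛ (λ i → c * g i)) n ≡ c * (f ⊛ g) n
⊛-*ʳ f c g n =
  trans (∑-cong (suc n) (λ i _ → x∙yz≈y∙xz (f i) c (g (n ∸ i)))) (sym (*-distribˡ-∑ (suc n) c _))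

⊛-*ˡ : ∀ c f g n → ((λ i → c * f i) ⊛ g) n ≡ c * (f ⊛ g) n
⊛-*ˡ c f g n =
  trans (∑-cong (suc n) (λ i _ → ℤₚ.*-assoc c (f i) (g (n ∸ i)))) (sym (*-distribˡ-∑ (suc n) c _))

⊛-negʳ : ∀ f g n → (f ⊛ (λ i → - g i)) n ≡ - (f ⊛ g) n
⊛-negʳ f g n = trans (∑-cong (suc n) (λ i _ → sym (ℤₚ.neg-distribʳ-* (f i) (g (n ∸ i))))) (∑-neg (suc n) _)

⊛-∑ʳ : ∀ f L (G : ℕ → Series) n → (f ⊛ (λ i → ∑[ m < L ] G m i)) n ≡ ∑[ m < L ] (f ⊛ G m) n
⊛-∑ʳ f L G n =
  trans (∑-cong (suc n) (λ i _ → *-distribˡ-∑ L (f i) (λ m → G m (n ∸ i)))) (∑-comm (suc n) L _)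

⊛-left-comm : ∀ f g k n → (f ⊛ g ⊛ k) n ≡ (g ⊛ f ⊛ k) n
⊛-left-comm f g k n = begin
  ∑[ i < suc n ] (f i * ∑[ j < suc (n ∸ i) ] (g j * k (n ∸ i ∸ j)))
    ≡⟨ ∑-cong (suc n) (λ i _ → *-distribˡ-∑ (suc (n ∸ i)) (f i) _) ⟩
  ∑[ i < suc n ] ∑[ j < suc (n ∸ i) ] (f i * (g j * k (n ∸ i ∸ j)))
    ≡⟨ ∑-triangle n (λ i j → f i * (g j * k (n ∸ i ∸ j))) ⟩
  ∑[ j < suc n ] ∑[ i < suc (n ∸ j) ] (f i * (g j * k (n ∸ i ∸ j)))
    ≡⟨ ∑-cong (suc n) (λ j _ → ∑-cong (suc (n ∸ j)) (λ i _ → exchange i j)) ⟩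
  ∑[ j < suc n ] ∑[ i < suc (n ∸ j) ] (g j * (f i * k (n ∸ j ∸ i)))
    ≡⟨ ∑-cong (suc n) (λ j _ → *-distribˡ-∑ (suc (n ∸ j)) (g j) _) ⟨
  ∑[ j < suc n ] (g j * ∑[ i < suc (n ∸ j) ] (f i * k (n ∸ j ∸ i)))
    ∎
  where
  open ≡-Reasoning
  exchange : ∀ i j → f i * (g j * k (n ∸ i ∸ j)) ≡ g j * (f i * k (n ∸ j ∸ i))
  exchange i j rewrite ℕₚ.∸-+-assoc n i j | ℕₚ.∸-+-assoc n j i | ℕₚ.+-comm i j =
    x∙yz≈y∙xz (f i) (g j) (k (n ∸ (j ℕ.+ i)))

X^-⊛-≤ : ∀ c F n → c ℕ.≤ n → (X^ c ⊛ F) n ≡ F (n ∸ c)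
X^-⊛-≤ c F n c≤n = begin
  (X^ c ⊛ F) n          ≡⟨ ∑-single (suc n) _ (s≤s c≤n) (λ i _ i≢c → cong (_* F (n ∸ i)) (X^-off i≢c)) ⟩
  X^ c c * F (n ∸ c)    ≡⟨ cong (_* F (n ∸ c)) (X^-diag c) ⟩
  + 1 * F (n ∸ c)       ≡⟨ ℤₚ.*-identityˡ _ ⟩
  F (n ∸ c)             ∎
  where open ≡-Reasoning

X^-⊛-> : ∀ c F n → n ℕ.< c → (X^ c ⊛ F) n ≡ + 0
X^-⊛-> c F n n<c = ∑-zero (suc n) (λ i i≤n → cong (_* F (n ∸ i)) (X^-off (i≢c i (ℕₚ.≤-pred i≤n))))
  where
  i≢c : ∀ i → i ℕ.≤ n → i ≢ c
  i≢c i i≤n refl = ℕₚ.<-irrefl refl (ℕₚ.<-≤-trans n<c i≤n)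

⊛-identityʳ : ∀ f n → (f ⊛ X^ 0) n ≡ f n
⊛-identityʳ f n = begin
  (f ⊛ X^ 0) n         ≡⟨ ∑-single (suc n) _ ℕₚ.≤-refl (λ i i≤n i≢n → trans (cong (f i *_) (X^-off (n∸i≢0 i≢n (ℕₚ.≤-pred i≤n)))) (ℤₚ.*-zeroʳ (f i))) ⟩
  f n * X^ 0 (n ∸ n)   ≡⟨ cong (λ k → f n * X^ 0 k) (ℕₚ.n∸n≡0 n) ⟩
  f n * + 1            ≡⟨ ℤₚ.*-identityʳ (f n) ⟩
  f n                  ∎
  where
  open ≡-Reasoning
  n∸i≢0 : ∀ {i} → i ≢ n → i ℕ.≤ n → n ∸ i ≢ 0
  n∸i≢0 i≢n i≤n n∸i≡0 = i≢n (ℕₚ.≤-antisym i≤n (ℕₚ.m∸n≡0⇒m≤n n∸i≡0))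

X^-⊛-X^ : ∀ a b F n → (X^ a ⊛ X^ b ⊛ F) n ≡ (X^ (a ℕ.+ b) ⊛ F) n
X^-⊛-X^ a b F n with a ℕ.≤? n | (a ℕ.+ b) ℕ.≤? n
... | no a≰n | _ = trans (X^-⊛-> a (X^ b ⊛ F) n (ℕₚ.≰⇒> a≰n))
  (sym (X^-⊛-> (a ℕ.+ b) F n (ℕₚ.<-≤-trans (ℕₚ.≰⇒> a≰n) (ℕₚ.m≤m+n a b))))
... | yes a≤n | yes a+b≤n = begin
  (X^ a ⊛ X^ b ⊛ F) n     ≡⟨ X^-⊛-≤ a (X^ b ⊛ F) n a≤n ⟩
  (X^ b ⊛ F) (n ∸ a)      ≡⟨ X^-⊛-≤ b F (n ∸ a) (ℕₚ.+-cancelˡ-≤ a b (n ∸ a) (subst (a ℕ.+ b ℕ.≤_) (sym (ℕₚ.m+[n∸m]≡n a≤n)) a+b≤n)) ⟩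
  F (n ∸ a ∸ b)           ≡⟨ cong F (ℕₚ.∸-+-assoc n a b) ⟩
  F (n ∸ (a ℕ.+ b))       ≡⟨ X^-⊛-≤ (a ℕ.+ b) F n a+b≤n ⟨
  (X^ (a ℕ.+ b) ⊛ F) n    ∎
  where open ≡-Reasoning
... | yes a≤n | no a+b≰n = begin
  (X^ a ⊛ X^ b ⊛ F) n     ≡⟨ X^-⊛-≤ a (X^ b ⊛ F) n a≤n ⟩
  (X^ b ⊛ F) (n ∸ a)      ≡⟨ X^-⊛-> b F (n ∸ a) (ℕₚ.+-cancelˡ-< a (n ∸ a) b (subst (ℕ._< a ℕ.+ b) (sym (ℕₚ.m+[n∸m]≡n a≤n)) (ℕₚ.≰⇒> a+b≰n))) ⟩
  + 0                     ≡⟨ X^-⊛-> (a ℕ.+ b) F n (ℕₚ.≰⇒> a+b≰n) ⟨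
  (X^ (a ℕ.+ b) ⊛ F) n    ∎
  where open ≡-Reasoning

X^-vanishesAbove : ∀ c → VanishesAbove c (X^ c)
X^-vanishesAbove c i c<i = X^-off (λ { refl → ℕₚ.<-irrefl refl c<i })

⊛-vanishesBelow : ∀ {a b} f g → VanishesBelow a f → VanishesBelow b g → VanishesBelow (a ℕ.+ b) (f ⊛ g)
⊛-vanishesBelow {a} {b} f g f₀ g₀ n n<a+b = ∑-zero (suc n) term≡0
  where
  term≡0 : ∀ i → i ℕ.< suc n → f i * g (n ∸ i) ≡ + 0
  term≡0 i i≤n with i ℕ.<? a
  ... | yes i<a = cong (_* g (n ∸ i)) (f₀ i i<a)
  ... | no  i≮a = trans (cong (f i *_) (g₀ (n ∸ i) n∸i<b)) (ℤₚ.*-zeroʳ (f i))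
    where
    open ℕₚ.≤-Reasoning
    n∸i<b : n ∸ i ℕ.< b
    n∸i<b = ℕₚ.+-cancelˡ-< i (n ∸ i) b (begin-strict
      i ℕ.+ (n ∸ i)   ≡⟨ ℕₚ.m+[n∸m]≡n (ℕₚ.≤-pred i≤n) ⟩
      n               <⟨ n<a+b ⟩
      a ℕ.+ b         ≤⟨ ℕₚ.+-monoˡ-≤ b (ℕₚ.≮⇒≥ i≮a) ⟩
      i ℕ.+ b         ∎)

⊛-vanishesAbove : ∀ {a b} f g → VanishesAbove a f → VanishesAbove b g → VanishesAbove (a ℕ.+ b) (f ⊛ g)
⊛-vanishesAbove {a} {b} f g f₀ g₀ n a+b<n = ∑-zero (suc n) term≡0
  where
  term≡0 : ∀ i → i ℕ.< suc n → f i * g (n ∸ i) ≡ + 0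
  term≡0 i i≤n with a ℕ.<? i
  ... | yes a<i = cong (_* g (n ∸ i)) (f₀ i a<i)
  ... | no  a≮i = trans (cong (f i *_) (g₀ (n ∸ i) b<n∸i)) (ℤₚ.*-zeroʳ (f i))
    where
    open ℕₚ.≤-Reasoning
    b<n∸i : b ℕ.< n ∸ i
    b<n∸i = ℕₚ.+-cancelˡ-< i b (n ∸ i) (begin-strict
      i ℕ.+ b         ≤⟨ ℕₚ.+-monoˡ-≤ b (ℕₚ.≮⇒≥ a≮i) ⟩
      a ℕ.+ b         <⟨ a+b<n ⟩
      n               ≡⟨ ℕₚ.m+[n∸m]≡n (ℕₚ.≤-pred i≤n) ⟨
      i ℕ.+ (n ∸ i)   ∎)

^⊛-vanishesBelow : ∀ h → h 0 ≡ + 0 → ∀ m → VanishesBelow m (h ^⊛ m)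
^⊛-vanishesBelow h h₀ zero    i ()
^⊛-vanishesBelow h h₀ (suc m) =
  ⊛-vanishesBelow h (h ^⊛ m) (λ { zero _ → h₀ ; (suc _) (s≤s ()) }) (^⊛-vanishesBelow h h₀ m)

^⊛-vanishesAbove : ∀ {q} h → VanishesAbove q h → ∀ m → VanishesAbove (m ℕ.* q) (h ^⊛ m)
^⊛-vanishesAbove h h-deg zero    = X^-vanishesAbove 0
^⊛-vanishesAbove h h-deg (suc m) = ⊛-vanishesAbove h (h ^⊛ m) h-deg (^⊛-vanishesAbove h h-deg m)

∂-⊛ : ∀ f g n → ∂ (f ⊛ g) n ≡ (∂ f ⊛ g) n + (f ⊛ ∂ g) n
∂-⊛ f g n = begin
  + suc n * (f ⊛ g) (suc n)
    ≡⟨ *-distribˡ-∑ (suc (suc n)) (+ suc n) _ ⟩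
  ∑[ i < suc (suc n) ] (+ suc n * (f i * g (suc n ∸ i)))
    ≡⟨ ∑-cong (suc (suc n)) (λ i i≤1+n → split i (ℕₚ.≤-pred i≤1+n)) ⟩
  ∑[ i < suc (suc n) ] (A i + B i)
    ≡⟨ ∑-distrib-+ (suc (suc n)) A B ⟩
  ∑ (suc (suc n)) A + ∑ (suc (suc n)) B
    ≡⟨ cong₂ _+_ (trans (∑-head (suc n) A) (ℤₚ.+-identityˡ (∑[ i < suc n ] A (suc i)))) B-sum ⟩
  (∂ f ⊛ g) n + (f ⊛ ∂ g) n
    ∎
  where
  open ≡-Reasoning
  A B : ℕ → ℤ
  A i = + i * f i * g (suc n ∸ i)
  B i = f i * (+ (suc n ∸ i) * g (suc n ∸ i))
  distrib : ∀ a b x y → (a + b) * (x * y) ≡ a * x * y + x * (b * y)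
  distrib = solve-∀
  split : ∀ i → i ℕ.≤ suc n → + suc n * (f i * g (suc n ∸ i)) ≡ A i + B i
  split i i≤1+n = begin
    + suc n * (f i * g (suc n ∸ i))                      ≡⟨ cong (λ k → + k * (f i * g (suc n ∸ i))) (ℕₚ.m+[n∸m]≡n i≤1+n) ⟨
    + (i ℕ.+ (suc n ∸ i)) * (f i * g (suc n ∸ i))        ≡⟨ cong (_* (f i * g (suc n ∸ i))) (ℤₚ.pos-+ i (suc n ∸ i)) ⟩
    (+ i + + (suc n ∸ i)) * (f i * g (suc n ∸ i))        ≡⟨ distrib (+ i) (+ (suc n ∸ i)) (f i) (g (suc n ∸ i)) ⟩
    A i + B i                                            ∎
  B-last : B (suc n) ≡ + 0
  B-last rewrite ℕₚ.n∸n≡0 n = ℤₚ.*-zeroʳ (f (suc n))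
  B-sum : ∑ (suc (suc n)) B ≡ (f ⊛ ∂ g) n
  B-sum = trans (cong (_+_ (∑ (suc n) B)) B-last) (trans (ℤₚ.+-identityʳ _)
    (∑-cong (suc n) (λ i i≤n → cong (λ k → f i * (+ k * g k)) (ℕₚ.+-∸-assoc 1 (ℕₚ.≤-pred i≤n)))))

∂-^⊛ : ∀ h m n → ∂ (h ^⊛ suc m) n ≡ + suc m * (∂ h ⊛ h ^⊛ m) n
∂-^⊛ h zero n = begin
  ∂ (h ⊛ X^ 0) n                        ≡⟨ ∂-⊛ h (X^ 0) n ⟩
  (∂ h ⊛ X^ 0) n + (h ⊛ ∂ (X^ 0)) n     ≡⟨ cong (_+_ ((∂ h ⊛ X^ 0) n)) (∑-zero (suc n) (λ i _ → ∂X^0≡0 i)) ⟩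
  (∂ h ⊛ X^ 0) n + + 0                  ≡⟨ ℤₚ.+-identityʳ _ ⟩
  (∂ h ⊛ X^ 0) n                        ≡⟨ ℤₚ.*-identityˡ _ ⟨
  + 1 * (∂ h ⊛ X^ 0) n                  ∎
  where
  open ≡-Reasoning
  ∂X^0≡0 : ∀ i → h i * ∂ (X^ 0) (n ∸ i) ≡ + 0
  ∂X^0≡0 i = trans (cong (λ x → h i * (+ suc (n ∸ i) * x)) (X^-off {0} {suc (n ∸ i)} (λ ())))
                   (trans (cong (h i *_) (ℤₚ.*-zeroʳ (+ suc (n ∸ i)))) (ℤₚ.*-zeroʳ (h i)))
∂-^⊛ h (suc m) n = begin
  ∂ (h ⊛ h ^⊛ suc m) n                                     ≡⟨ ∂-⊛ h (h ^⊛ suc m) n ⟩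
  R + (h ⊛ ∂ (h ^⊛ suc m)) n                               ≡⟨ cong (_+_ R) (⊛-congʳ h (∂-^⊛ h m) n) ⟩
  R + (h ⊛ (λ i → + suc m * (∂ h ⊛ h ^⊛ m) i)) n          ≡⟨ cong (_+_ R) (⊛-*ʳ h (+ suc m) (∂ h ⊛ h ^⊛ m) n) ⟩
  R + + suc m * (h ⊛ ∂ h ⊛ h ^⊛ m) n                       ≡⟨ cong (λ x → R + + suc m * x) (⊛-left-comm h (∂ h) (h ^⊛ m) n) ⟩
  R + + suc m * R                                          ≡⟨ collect R (+ suc m) ⟩
  + suc (suc m) * R                                        ∎
  where
  open ≡-Reasoning
  R = (∂ h ⊛ h ^⊛ suc m) n
  collect : ∀ x k → x + k * x ≡ (+ 1 + k) * x
  collect = solve-∀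

∣∂-^⊛∣ : ∀ h m N → suc N ℕ.* ℤ.∣ (h ^⊛ suc m) (suc N) ∣ ≡ suc m ℕ.* ℤ.∣ (∂ h ⊛ h ^⊛ m) N ∣
∣∂-^⊛∣ h m N = trans (sym (ℤₚ.abs-* (+ suc N) ((h ^⊛ suc m) (suc N))))
  (trans (cong ℤ.∣_∣ (∂-^⊛ h m N)) (ℤₚ.abs-* (+ suc m) ((∂ h ⊛ h ^⊛ m) N)))

-- Expansions of ∂h / (1 + k h) and of (x^q + L)^M

⊛-agree-below : ∀ h {X X′} N → h 0 ≡ + 0 → (∀ j → j ℕ.< N → X j ≡ X′ j) → (h ⊛ X) N ≡ (h ⊛ X′) N
⊛-agree-below h {X} {X′} N h₀ X≡X′ = ∑-cong (suc N) summand
  where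
  summand : ∀ i → i ℕ.< suc N → h i * X (N ∸ i) ≡ h i * X′ (N ∸ i)
  summand zero    _         = trans (cong (_* X N) h₀) (sym (cong (_* X′ N) h₀))
  summand (suc i) (s≤s i<N) = cong (h (suc i) *_) (X≡X′ (N ∸ suc i) (ℕₚ.∸-monoʳ-< (s≤s z≤n) i<N))

solutions-agree : ∀ h k (X X′ Y : Series) {L} → h 0 ≡ + 0 →
  (∀ N → N ℕ.< L → X N + k * (h ⊛ X) N ≡ Y N) →
  (∀ N → N ℕ.< L → X′ N + k * (h ⊛ X′) N ≡ Y N) →
  ∀ N → N ℕ.< L → X N ≡ X′ N
solutions-agree h k X X′ Y {L} h₀ X-solves X′-solves = <-rec (λ N → N ℕ.< L → X N ≡ X′ N) step
  where
  step : ∀ N → (∀ {j} → j ℕ.< N → j ℕ.< L → X j ≡ X′ j) → N ℕ.< L → X N ≡ X′ N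
  step N ih N<L = ∙-cancelʳ (k * (h ⊛ X) N) (X N) (X′ N) (begin
    X N + k * (h ⊛ X) N     ≡⟨ X-solves N N<L ⟩
    Y N                     ≡⟨ X′-solves N N<L ⟨
    X′ N + k * (h ⊛ X′) N   ≡⟨ cong (λ t → X′ N + k * t) (⊛-agree-below h N h₀ (λ j j<N → ih j<N (ℕₚ.<-trans j<N N<L))) ⟨
    X′ N + k * (h ⊛ X) N    ∎)
    where open ≡-Reasoning

-- the sum of the first L terms of  ∂h / (1 + k h) = ∑ₘ (- k)ᵐ (∂h) hᵐ
geometricQuotient : Series → ℤ → ℕ → Series
geometricQuotient h k L i = ∑[ m < L ] ((- k) ^ m * (∂ h ⊛ h ^⊛ m) i)

geometricQuotient-solves : ∀ h k L N → let Q = geometricQuotient h k L in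
  Q N + k * (h ⊛ Q) N ≡ ∂ h N - (- k) ^ L * (∂ h ⊛ h ^⊛ L) N
geometricQuotient-solves h k L N = begin
  Q N + k * (h ⊛ Q) N
    ≡⟨ cong (λ t → Q N + k * t) (⊛-∑ʳ h L (λ m i → (- k) ^ m * (∂ h ⊛ h ^⊛ m) i) N) ⟩
  Q N + k * ∑[ m < L ] (h ⊛ (λ i → (- k) ^ m * (∂ h ⊛ h ^⊛ m) i)) N
    ≡⟨ cong (λ t → Q N + t) (*-distribˡ-∑ L k _) ⟩
  Q N + ∑[ m < L ] (k * (h ⊛ (λ i → (- k) ^ m * (∂ h ⊛ h ^⊛ m) i)) N)
    ≡⟨ cong (λ t → Q N + t) (∑-cong L (λ m _ → shift m)) ⟩
  Q N + ∑[ m < L ] (- ((- k) ^ suc m * (∂ h ⊛ h ^⊛ suc m) N))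
    ≡⟨ cong (λ t → Q N + t) (∑-neg L _) ⟩
  Q N - ∑[ m < L ] ((- k) ^ suc m * (∂ h ⊛ h ^⊛ suc m) N)
    ≡⟨ ∑-telescope L (λ m → (- k) ^ m * (∂ h ⊛ h ^⊛ m) N) ⟩
  + 1 * (∂ h ⊛ X^ 0) N - (- k) ^ L * (∂ h ⊛ h ^⊛ L) N
    ≡⟨ cong (λ t → t - (- k) ^ L * (∂ h ⊛ h ^⊛ L) N) (trans (ℤₚ.*-identityˡ _) (⊛-identityʳ (∂ h) N)) ⟩
  ∂ h N - (- k) ^ L * (∂ h ⊛ h ^⊛ L) N
    ∎
  where
  open ≡-Reasoning
  Q = geometricQuotient h k L
  rearrange : ∀ k a x → k * (a * x) ≡ - (- k * a * x)
  rearrange = solve-∀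
  shift : ∀ m → k * (h ⊛ (λ i → (- k) ^ m * (∂ h ⊛ h ^⊛ m) i)) N ≡ - ((- k) ^ suc m * (∂ h ⊛ h ^⊛ suc m) N)
  shift m = begin
    k * (h ⊛ (λ i → (- k) ^ m * (∂ h ⊛ h ^⊛ m) i)) N   ≡⟨ cong (k *_) (⊛-*ʳ h ((- k) ^ m) (∂ h ⊛ h ^⊛ m) N) ⟩
    k * ((- k) ^ m * (h ⊛ ∂ h ⊛ h ^⊛ m) N)             ≡⟨ cong (λ t → k * ((- k) ^ m * t)) (⊛-left-comm h (∂ h) (h ^⊛ m) N) ⟩
    k * ((- k) ^ m * (∂ h ⊛ h ^⊛ suc m) N)             ≡⟨ rearrange k ((- k) ^ m) _ ⟩
    - ((- k) ^ suc m * (∂ h ⊛ h ^⊛ suc m) N)           ∎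

quotient-expansion : ∀ h k (X : Series) → h 0 ≡ + 0 → (∀ N → X N + k * (h ⊛ X) N ≡ - ∂ h N) →
  ∀ N → X N ≡ - ∑[ m < suc N ] ((- k) ^ m * (∂ h ⊛ h ^⊛ m) N)
quotient-expansion h k X h₀ X-solves N =
  solutions-agree h k X (λ i → - Q i) (λ i → - ∂ h i) h₀ (λ N′ _ → X-solves N′) -Q-solves N ℕₚ.≤-refl
  where
  Q = geometricQuotient h k (suc N)
  pull-neg : ∀ q k t → - q + k * - t ≡ - (q + k * t)
  pull-neg = solve-∀
  drop-zero : ∀ d r → d - r * + 0 ≡ d
  drop-zero = solve-∀
  -Q-solves : ∀ N′ → N′ ℕ.< suc N → - Q N′ + k * (h ⊛ (λ i → - Q i)) N′ ≡ - ∂ h N′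
  -Q-solves N′ N′<1+N = begin
    - Q N′ + k * (h ⊛ (λ i → - Q i)) N′                  ≡⟨ cong (λ t → - Q N′ + k * t) (⊛-negʳ h Q N′) ⟩
    - Q N′ + k * - (h ⊛ Q) N′                            ≡⟨ pull-neg (Q N′) k ((h ⊛ Q) N′) ⟩
    - (Q N′ + k * (h ⊛ Q) N′)                            ≡⟨ cong -_ (geometricQuotient-solves h k (suc N) N′) ⟩
    - (∂ h N′ - (- k) ^ suc N * (∂ h ⊛ h ^⊛ suc N) N′)   ≡⟨ cong (λ t → - (∂ h N′ - (- k) ^ suc N * t)) tail≡0 ⟩
    - (∂ h N′ - (- k) ^ suc N * + 0)                     ≡⟨ cong -_ (drop-zero (∂ h N′) ((- k) ^ suc N)) ⟩
    - ∂ h N′                                             ∎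
    where
    open ≡-Reasoning
    tail≡0 : (∂ h ⊛ h ^⊛ suc N) N′ ≡ + 0
    tail≡0 = ⊛-vanishesBelow {0} (∂ h) (h ^⊛ suc N) (λ _ ()) (^⊛-vanishesBelow h h₀ (suc N)) N′ N′<1+N

module _ (q : ℕ) (h L : Series) (h≡X^q+L : ∀ i → h i ≡ X^ q i + L i) where

  private
    binomialTerm : ℕ → ℕ → Series
    binomialTerm M j = X^ ((M ∸ j) ℕ.* q) ⊛ L ^⊛ j

    ⊛-binomialTerm : ∀ M j → j ℕ.≤ M → ∀ n →
      (h ⊛ binomialTerm M j) n ≡ binomialTerm (suc M) j n + binomialTerm (suc M) (suc j) n
    ⊛-binomialTerm M j j≤M n = begin
      (h ⊛ binomialTerm M j) n
        ≡⟨ ⊛-congˡ (binomialTerm M j) h≡X^q+L n ⟩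
      ((λ i → X^ q i + L i) ⊛ binomialTerm M j) n
        ≡⟨ ⊛-distribʳ-+ (X^ q) L (binomialTerm M j) n ⟩
      (X^ q ⊛ binomialTerm M j) n + (L ⊛ binomialTerm M j) n
        ≡⟨ cong₂ _+_ (X^-⊛-X^ q ((M ∸ j) ℕ.* q) (L ^⊛ j) n) (⊛-left-comm L (X^ ((M ∸ j) ℕ.* q)) (L ^⊛ j) n) ⟩
      (X^ (suc (M ∸ j) ℕ.* q) ⊛ L ^⊛ j) n + binomialTerm (suc M) (suc j) n
        ≡⟨ cong (λ e → (X^ (e ℕ.* q) ⊛ L ^⊛ j) n + binomialTerm (suc M) (suc j) n) (ℕₚ.+-∸-assoc 1 j≤M) ⟨
      binomialTerm (suc M) j n + binomialTerm (suc M) (suc j) n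
        ∎
      where open ≡-Reasoning

  ^⊛-binomial : ∀ M n → (h ^⊛ M) n ≡ ∑[ j < suc M ] (+ (M C j) * (X^ ((M ∸ j) ℕ.* q) ⊛ L ^⊛ j) n)
  ^⊛-binomial zero n =
    sym (trans (ℤₚ.+-identityˡ _) (trans (ℤₚ.*-identityˡ _) (X^-⊛-≤ 0 (X^ 0) n z≤n)))
  ^⊛-binomial (suc M) n = begin
    (h ⊛ h ^⊛ M) n
      ≡⟨ ⊛-congʳ h (^⊛-binomial M) n ⟩
    (h ⊛ (λ i → ∑[ j < suc M ] (+ (M C j) * binomialTerm M j i))) n
      ≡⟨ ⊛-∑ʳ h (suc M) (λ j i → + (M C j) * binomialTerm M j i) n ⟩
    ∑[ j < suc M ] (h ⊛ (λ i → + (M C j) * binomialTerm M j i)) n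
      ≡⟨ ∑-cong (suc M) (λ j j<1+M → trans (⊛-*ʳ h (+ (M C j)) (binomialTerm M j) n)
                                            (cong (+ (M C j) *_) (⊛-binomialTerm M j (ℕₚ.≤-pred j<1+M) n))) ⟩
    ∑[ j < suc M ] (+ (M C j) * (binomialTerm (suc M) j n + binomialTerm (suc M) (suc j) n))
      ≡⟨ ∑-pascal M (λ j → binomialTerm (suc M) j n) ⟩
    ∑[ j < suc (suc M) ] (+ (suc M C j) * binomialTerm (suc M) j n)
      ∎
    where open ≡-Reasoning

-- Divisibility by prime powers

^-monoʳ-∣ : ∀ p {a b} → a ℕ.≤ b → p ℕ.^ a ∣ p ℕ.^ b
^-monoʳ-∣ p {a} a≤b with ℕₚ.m≤n⇒∃[o]m+o≡n a≤b
... | k , refl = divides (p ℕ.^ k) (trans (ℕₚ.^-distribˡ-+-* p a k) (ℕₚ.*-comm (p ℕ.^ a) (p ℕ.^ k)))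

∣i^n∣≡∣i∣^n : ∀ i n → ℤ.∣ i ^ n ∣ ≡ ℤ.∣ i ∣ ℕ.^ n
∣i^n∣≡∣i∣^n i zero    = refl
∣i^n∣≡∣i∣^n i (suc n) = trans (ℤₚ.abs-* i (i ^ n)) (cong (ℤ.∣ i ∣ ℕ.*_) (∣i^n∣≡∣i∣^n i n))

u+[v∸d]≤v+[u∸d] : ∀ u {v d} → d ℕ.≤ v → u ℕ.+ (v ∸ d) ℕ.≤ v ℕ.+ (u ∸ d)
u+[v∸d]≤v+[u∸d] u {v} {d} d≤v = begin
  u ℕ.+ (v ∸ d)                    ≤⟨ ℕₚ.+-monoˡ-≤ (v ∸ d) (ℕₚ.m≤n+m∸n u d) ⟩
  d ℕ.+ (u ∸ d) ℕ.+ (v ∸ d)        ≡⟨ cong (ℕ._+ (v ∸ d)) (ℕₚ.+-comm d (u ∸ d)) ⟩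
  (u ∸ d) ℕ.+ d ℕ.+ (v ∸ d)        ≡⟨ ℕₚ.+-assoc (u ∸ d) d (v ∸ d) ⟩
  (u ∸ d) ℕ.+ (d ℕ.+ (v ∸ d))      ≡⟨ cong ((u ∸ d) ℕ.+_) (ℕₚ.m+[n∸m]≡n d≤v) ⟩
  (u ∸ d) ℕ.+ v                    ≡⟨ ℕₚ.+-comm (u ∸ d) v ⟩
  v ℕ.+ (u ∸ d)                    ∎
  where open ℕₚ.≤-Reasoning

[k+1]*[n+1]C[k+1]≡[n+1]*nCk : ∀ n k → suc k ℕ.* (suc n C suc k) ≡ suc n ℕ.* (n C k)
[k+1]*[n+1]C[k+1]≡[n+1]*nCk zero zero    = refl
[k+1]*[n+1]C[k+1]≡[n+1]*nCk zero (suc k) =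
  trans (cong (suc (suc k) ℕ.*_) (k>n⇒nCk≡0 {1} {suc (suc k)} (s≤s (s≤s z≤n)))) (ℕₚ.*-zeroʳ (suc (suc k)))
[k+1]*[n+1]C[k+1]≡[n+1]*nCk (suc n) k = begin
  suc k ℕ.* (suc (suc n) C suc k)
    ≡⟨ cong (suc k ℕ.*_) (nCk+nC[k+1]≡[n+1]C[k+1] (suc n) k) ⟨
  suc k ℕ.* (suc n C k ℕ.+ suc n C suc k)
    ≡⟨ ℕₚ.*-distribˡ-+ (suc k) (suc n C k) (suc n C suc k) ⟩
  suc k ℕ.* (suc n C k) ℕ.+ suc k ℕ.* (suc n C suc k)
    ≡⟨ cong (suc k ℕ.* (suc n C k) ℕ.+_) ([k+1]*[n+1]C[k+1]≡[n+1]*nCk n k) ⟩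
  suc k ℕ.* (suc n C k) ℕ.+ suc n ℕ.* (n C k)
    ≡⟨ lower k ⟩
  suc (suc n) ℕ.* (suc n C k)
    ∎
  where
  open ≡-Reasoning
  lower : ∀ k → suc k ℕ.* (suc n C k) ℕ.+ suc n ℕ.* (n C k) ≡ suc (suc n) ℕ.* (suc n C k)
  lower zero    = refl
  lower (suc j) = begin
    suc n C suc j ℕ.+ suc j ℕ.* (suc n C suc j) ℕ.+ suc n ℕ.* (n C suc j)
      ≡⟨ ℕₚ.+-assoc (suc n C suc j) (suc j ℕ.* (suc n C suc j)) (suc n ℕ.* (n C suc j)) ⟩
    suc n C suc j ℕ.+ (suc j ℕ.* (suc n C suc j) ℕ.+ suc n ℕ.* (n C suc j))
      ≡⟨ cong (λ t → suc n C suc j ℕ.+ (t ℕ.+ suc n ℕ.* (n C suc j))) ([k+1]*[n+1]C[k+1]≡[n+1]*nCk n j) ⟩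
    suc n C suc j ℕ.+ (suc n ℕ.* (n C j) ℕ.+ suc n ℕ.* (n C suc j))
      ≡⟨ cong (suc n C suc j ℕ.+_) (ℕₚ.*-distribˡ-+ (suc n) (n C j) (n C suc j)) ⟨
    suc n C suc j ℕ.+ suc n ℕ.* (n C j ℕ.+ n C suc j)
      ≡⟨ cong (λ t → suc n C suc j ℕ.+ suc n ℕ.* t) (nCk+nC[k+1]≡[n+1]C[k+1] n j) ⟩
    suc n C suc j ℕ.+ suc n ℕ.* (suc n C suc j)
      ∎

bernoulli : ∀ q k → 1 ℕ.+ q ℕ.* k ℕ.≤ suc q ℕ.^ k
bernoulli q zero    = ℕₚ.≤-reflexive (cong suc (ℕₚ.*-zeroʳ q))
bernoulli q (suc k) = begin
  1 ℕ.+ q ℕ.* suc k                   ≡⟨ shift q k ⟩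
  1 ℕ.+ q ℕ.* k ℕ.+ q                 ≤⟨ ℕₚ.+-monoˡ-≤ q (bernoulli q k) ⟩
  suc q ℕ.^ k ℕ.+ q                   ≤⟨ ℕₚ.+-monoʳ-≤ (suc q ℕ.^ k) (ℕₚ.m≤m*n q (suc q ℕ.^ k) {{ℕₚ.m^n≢0 (suc q) k}}) ⟩
  suc q ℕ.^ k ℕ.+ q ℕ.* suc q ℕ.^ k   ∎
  where
  open ℕₚ.≤-Reasoning
  shift : ∀ q k → 1 ℕ.+ q ℕ.* suc k ≡ 1 ℕ.+ q ℕ.* k ℕ.+ q
  shift = ℕ-solve-∀

module _ {p} (p-prime : Prime p) where

  private
    instance
      p≢0 : NonZero p
      p≢0 = prime⇒nonZero p-prime

  p≥2 : 2 ℕ.≤ p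
  p≥2 = ℕ.nonTrivial⇒n>1 p {{prime⇒nonTrivial p-prime}}

  ^∣-cancel-coprime : ∀ {w} t {x} → ¬ p ∣ w → p ℕ.^ t ∣ w ℕ.* x → p ℕ.^ t ∣ x
  ^∣-cancel-coprime zero        p∤w _ = 1∣ _
  ^∣-cancel-coprime {w} (suc t) {x} p∤w p^[1+t]∣wx with euclidsLemma w x p-prime (∣-trans (m∣m*n (p ℕ.^ t)) p^[1+t]∣wx)
  ... | inj₁ p∣w = contradiction p∣w p∤w
  ... | inj₂ (divides y refl) =
    subst (p ℕ.* p ℕ.^ t ∣_) (ℕₚ.*-comm p y) (*-monoʳ-∣ p (^∣-cancel-coprime t p∤w (*-cancelˡ-∣ p p^[1+t]∣p[wy])))
    where
    rearrange : ∀ a b c → a ℕ.* (b ℕ.* c) ≡ c ℕ.* (a ℕ.* b)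
    rearrange = ℕ-solve-∀
    p^[1+t]∣p[wy] : p ℕ.* p ℕ.^ t ∣ p ℕ.* (w ℕ.* y)
    p^[1+t]∣p[wy] = subst (p ℕ.* p ℕ.^ t ∣_) (rearrange w y p) p^[1+t]∣wx

  ^∣-cancel : ∀ d u j {c} → p ℕ.^ u ∣ j ℕ.* c → ¬ p ℕ.^ suc d ∣ j → p ℕ.^ (u ∸ d) ∣ c
  ^∣-cancel zero    u j p^u∣jc p∤j =
    ^∣-cancel-coprime u (λ p∣j → p∤j (subst (_∣ j) (sym (ℕₚ.*-identityʳ p)) p∣j)) p^u∣jc
  ^∣-cancel (suc d) u j {c} p^u∣jc p^[2+d]∤j with p ∣? j
  ... | no p∤j = ∣-trans (^-monoʳ-∣ p (ℕₚ.m∸n≤m u (suc d))) (^∣-cancel-coprime u p∤j p^u∣jc)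
  ... | yes (divides j′ refl) with u
  ...   | zero    = 1∣ c
  ...   | suc u′  = ^∣-cancel d u′ j′ (*-cancelˡ-∣ p (subst (p ℕ.* p ℕ.^ u′ ∣_) (rearrange j′ p c) p^u∣jc)) p^[1+d]∤j′
    where
    rearrange : ∀ a b c → a ℕ.* b ℕ.* c ≡ b ℕ.* (a ℕ.* c)
    rearrange = ℕ-solve-∀
    p^[1+d]∤j′ : ¬ p ℕ.^ suc d ∣ j′
    p^[1+d]∤j′ p^[1+d]∣j′ = p^[2+d]∤j (subst (p ℕ.* p ℕ.^ suc d ∣_) (ℕₚ.*-comm p j′) (*-monoʳ-∣ p p^[1+d]∣j′))

  ^∣-binomial : ∀ d u M j → p ℕ.^ u ∣ M → ¬ p ℕ.^ suc d ∣ suc j → p ℕ.^ (u ∸ d) ∣ M C suc j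
  ^∣-binomial d u zero    j _     _         = _ ∣0
  ^∣-binomial d u (suc M) j p^u∣M p^[1+d]∤j = ^∣-cancel d u (suc j)
    (subst (p ℕ.^ u ∣_) (sym ([k+1]*[n+1]C[k+1]≡[n+1]*nCk M j)) (∣-trans p^u∣M (m∣m*n (M C j)))) p^[1+d]∤j

  factor-p-power : ∀ n → 0 ℕ.< n → ∃₂ λ v w → n ≡ p ℕ.^ v ℕ.* w × ¬ p ∣ w
  factor-p-power = <-rec _ factor
    where
    reassoc : ∀ a b c → a ℕ.* b ℕ.* c ≡ c ℕ.* a ℕ.* b
    reassoc = ℕ-solve-∀
    factor : ∀ n → (∀ {m} → m ℕ.< n → 0 ℕ.< m → ∃₂ λ v w → m ≡ p ℕ.^ v ℕ.* w × ¬ p ∣ w) →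
             0 ℕ.< n → ∃₂ λ v w → n ≡ p ℕ.^ v ℕ.* w × ¬ p ∣ w
    factor n rec 0<n with p ∣? n
    ... | no p∤n = 0 , n , sym (ℕₚ.+-identityʳ n) , p∤n
    ... | yes (divides zero    refl) = contradiction 0<n (ℕₚ.<-irrefl refl)
    ... | yes (divides (suc m) refl) with rec (ℕₚ.m<m*n (suc m) p p≥2) (s≤s z≤n)
    ...   | v , w , 1+m≡p^v*w , p∤w = suc v , w , trans (cong (ℕ._* p) 1+m≡p^v*w) (reassoc (p ℕ.^ v) w p) , p∤w

-- Finite differences

sgn-+ : ∀ m n → sgn (m ℕ.+ n) ≡ sgn m * sgn n
sgn-+ zero    n = sym (ℤₚ.*-identityˡ (sgn n))
sgn-+ (suc m) n = trans (cong -_ (sgn-+ m n)) (ℤₚ.neg-distribˡ-* (sgn m) (sgn n))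

sgn-odd : ∀ n → ¬ 2 ∣ n → sgn n ≡ - + 1
sgn-odd zero          2∤0   = contradiction (2 ∣0) 2∤0
sgn-odd (suc zero)    _     = refl
sgn-odd (suc (suc n)) 2∤2+n =
  trans (ℤₚ.neg-involutive (sgn n)) (sgn-odd n (λ 2∣n → 2∤2+n (∣m∣n⇒∣m+n (∣-refl {2}) 2∣n)))

Δ : Series → Series
Δ F n = F (suc n) - F n

Δ^ : ℕ → Series → Series
Δ^ t F n = ∑[ i < suc t ] (+ (t C i) * (sgn i * F (n ℕ.+ (t ∸ i))))

Δ^-cong : ∀ t {F G} → (∀ n → F n ≡ G n) → ∀ n → Δ^ t F n ≡ Δ^ t G n
Δ^-cong t F≡G n = ∑-cong (suc t) (λ i _ → cong (λ x → + (t C i) * (sgn i * x)) (F≡G _))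

Δ^-suc : ∀ t F n → Δ^ (suc t) F n ≡ Δ^ t (Δ F) n
Δ^-suc t F n = trans (sym (∑-pascal t V)) (∑-cong (suc t) (λ j j≤t → cong (+ (t C j) *_) (V-step j (ℕₚ.≤-pred j≤t))))
  where
  V : ℕ → ℤ
  V j = sgn j * F (n ℕ.+ (suc t ∸ j))
  factor : ∀ s x y → s * x + - s * y ≡ s * (x - y)
  factor = solve-∀
  V-step : ∀ j → j ℕ.≤ t → V j + V (suc j) ≡ sgn j * Δ F (n ℕ.+ (t ∸ j))
  V-step j j≤t rewrite ℕₚ.+-∸-assoc 1 j≤t | ℕₚ.+-suc n (t ∸ j) =
    factor (sgn j) (F (suc (n ℕ.+ (t ∸ j)))) (F (n ℕ.+ (t ∸ j)))

Δ-column : ∀ k n → Δ (λ m → + (m C suc k)) n ≡ + (n C k)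
Δ-column k n = begin
  + (suc n C suc k) - + (n C suc k)                ≡⟨ cong (λ c → + c - + (n C suc k)) (nCk+nC[k+1]≡[n+1]C[k+1] n k) ⟨
  + (n C k ℕ.+ n C suc k) - + (n C suc k)          ≡⟨ cong (_- + (n C suc k)) (ℤₚ.pos-+ (n C k) (n C suc k)) ⟩
  + (n C k) + + (n C suc k) - + (n C suc k)        ≡⟨ cancel (+ (n C k)) (+ (n C suc k)) ⟩
  + (n C k)                                        ∎
  where
  open ≡-Reasoning
  cancel : ∀ x y → x + y - y ≡ x
  cancel = solve-∀

Δ^-column : ∀ t k n → Δ^ t (λ m → + (m C (t ℕ.+ k))) n ≡ + (n C k)
Δ^-column zero    k n = trans (ℤₚ.+-identityˡ _) (trans (ℤₚ.*-identityˡ _) (trans (ℤₚ.*-identityˡ _)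
  (cong (λ m → + (m C k)) (ℕₚ.+-identityʳ n))))
Δ^-column (suc t) k n = trans (Δ^-suc t (λ m → + (m C (suc t ℕ.+ k))) n) (trans (Δ^-cong t (Δ-column (t ℕ.+ k)) n) (Δ^-column t k n))

Δ^-column-below : ∀ t k n → k ℕ.< t → Δ^ t (λ m → + (m C k)) n ≡ + 0
Δ^-column-below (suc t) zero    n _ = trans (Δ^-suc t (λ m → + (m C 0)) n)
  (∑-zero (suc t) (λ i _ → trans (cong (+ (t C i) *_) (ℤₚ.*-zeroʳ (sgn i))) (ℤₚ.*-zeroʳ (+ (t C i)))))
Δ^-column-below (suc t) (suc k) n (s≤s k<t) =
  trans (Δ^-suc t (λ m → + (m C suc k)) n) (trans (Δ^-cong t (Δ-column k) n) (Δ^-column-below t k n k<t))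

χ : ℕ → ℕ → ℤ
χ p k with p ∣? k
... | yes _ = + 1
... | no  _ = + 0

a : ℕ → ℕ → ℤ
a p n = ∑[ k < suc n ] (χ p k * sgn k * + (n C k))

χ-periodic : ∀ p k → χ p (p ℕ.+ k) ≡ χ p k
χ-periodic p k with p ∣? (p ℕ.+ k) | p ∣? k
... | yes _     | yes _   = refl
... | no  _     | no  _   = refl
... | yes p∣p+k | no p∤k  = contradiction (∣m+n∣m⇒∣n p∣p+k ∣-refl) p∤k
... | no p∤p+k  | yes p∣k = contradiction (∣m∣n⇒∣m+n ∣-refl p∣k) p∤p+k

a-extend : ∀ p n K → n ℕ.< K → ∑[ k < K ] (χ p k * sgn k * + (n C k)) ≡ a p n
a-extend p n K n<K = ∑-extend _ n<K (λ k n<k →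
  trans (cong (λ c → χ p k * sgn k * + c) (k>n⇒nCk≡0 n<k)) (ℤₚ.*-zeroʳ (χ p k * sgn k)))

Δ^-a : ∀ p t N K → N ℕ.+ t ℕ.< K → Δ^ t (a p) N ≡ ∑[ k < K ] (χ p k * sgn k * Δ^ t (λ m → + (m C k)) N)
Δ^-a p t N K N+t<K = begin
  ∑[ i < suc t ] (+ (t C i) * (sgn i * a p (N ℕ.+ (t ∸ i))))
    ≡⟨ ∑-cong (suc t) (λ i _ → expand i) ⟩
  ∑[ i < suc t ] ∑[ k < K ] (χ p k * sgn k * (+ (t C i) * (sgn i * + ((N ℕ.+ (t ∸ i)) C k))))
    ≡⟨ ∑-comm (suc t) K _ ⟩
  ∑[ k < K ] ∑[ i < suc t ] (χ p k * sgn k * (+ (t C i) * (sgn i * + ((N ℕ.+ (t ∸ i)) C k))))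
    ≡⟨ ∑-cong K (λ k _ → *-distribˡ-∑ (suc t) (χ p k * sgn k) _) ⟨
  ∑[ k < K ] (χ p k * sgn k * Δ^ t (λ m → + (m C k)) N)
    ∎
  where
  open ≡-Reasoning
  rearrange : ∀ x s y z → x * (s * (y * z)) ≡ y * (x * (s * z))
  rearrange = solve-∀
  expand : ∀ i → + (t C i) * (sgn i * a p (N ℕ.+ (t ∸ i)))
               ≡ ∑[ k < K ] (χ p k * sgn k * (+ (t C i) * (sgn i * + ((N ℕ.+ (t ∸ i)) C k))))
  expand i = begin
    + (t C i) * (sgn i * a p M)
      ≡⟨ cong (λ x → + (t C i) * (sgn i * x)) (a-extend p M K (ℕₚ.≤-<-trans (ℕₚ.+-monoʳ-≤ N (ℕₚ.m∸n≤m t i)) N+t<K)) ⟨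
    + (t C i) * (sgn i * ∑[ k < K ] (χ p k * sgn k * + (M C k)))
      ≡⟨ cong (+ (t C i) *_) (*-distribˡ-∑ K (sgn i) _) ⟩
    + (t C i) * ∑[ k < K ] (sgn i * (χ p k * sgn k * + (M C k)))
      ≡⟨ *-distribˡ-∑ K (+ (t C i)) _ ⟩
    ∑[ k < K ] (+ (t C i) * (sgn i * (χ p k * sgn k * + (M C k))))
      ≡⟨ ∑-cong K (λ k _ → rearrange (+ (t C i)) (sgn i) (χ p k * sgn k) (+ (M C k))) ⟩
    ∑[ k < K ] (χ p k * sgn k * (+ (t C i) * (sgn i * + (M C k))))
      ∎
    where
    M = N ℕ.+ (t ∸ i)

Δ^p-a : ∀ p → ¬ 2 ∣ p → ∀ N → Δ^ p (a p) N ≡ - a p N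
Δ^p-a p p-odd N = begin
  Δ^ p (a p) N
    ≡⟨ Δ^-a p p N (p ℕ.+ suc N) (ℕₚ.≤-reflexive (trans (cong suc (ℕₚ.+-comm N p)) (sym (ℕₚ.+-suc p N)))) ⟩
  ∑[ k < p ℕ.+ suc N ] (c k * Δ^ p (λ m → + (m C k)) N)
    ≡⟨ ∑-split p (suc N) _ ⟩
  ∑[ k < p ] (c k * Δ^ p (λ m → + (m C k)) N) + ∑[ k < suc N ] (c (p ℕ.+ k) * Δ^ p (λ m → + (m C (p ℕ.+ k))) N)
    ≡⟨ cong₂ _+_ (∑-zero p (λ k k<p → trans (cong (c k *_) (Δ^-column-below p k N k<p)) (ℤₚ.*-zeroʳ (c k))))
                 (∑-cong (suc N) (λ k _ → cong₂ _*_ (c-periodic k) (Δ^-column p k N))) ⟩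
  + 0 + ∑[ k < suc N ] (- c k * + (N C k))
    ≡⟨ ℤₚ.+-identityˡ _ ⟩
  ∑[ k < suc N ] (- c k * + (N C k))
    ≡⟨ ∑-cong (suc N) (λ k _ → sym (ℤₚ.neg-distribˡ-* (c k) (+ (N C k)))) ⟩
  ∑[ k < suc N ] (- (c k * + (N C k)))
    ≡⟨ ∑-neg (suc N) _ ⟩
  - a p N
    ∎
  where
  open ≡-Reasoning
  c : ℕ → ℤ
  c k = χ p k * sgn k
  flip : ∀ x s → x * (- + 1 * s) ≡ - (x * s)
  flip = solve-∀
  c-periodic : ∀ k → c (p ℕ.+ k) ≡ - c k
  c-periodic k = begin
    χ p (p ℕ.+ k) * sgn (p ℕ.+ k)   ≡⟨ cong₂ _*_ (χ-periodic p k) (trans (sgn-+ p k) (cong (_* sgn k) (sgn-odd p p-odd))) ⟩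
    χ p k * (- + 1 * sgn k)         ≡⟨ flip (χ p k) (sgn k) ⟩
    - c k                           ∎

χ-zero : ∀ p → χ p 0 ≡ + 1
χ-zero p with p ∣? 0
... | yes _   = refl
... | no  p∤0 = contradiction (p ∣0) p∤0

χ-below : ∀ p k → 0 ℕ.< k → k ℕ.< p → χ p k ≡ + 0
χ-below p k 0<k k<p with p ∣? k
... | yes p∣k = contradiction (∣⇒≤ {{ℕ.>-nonZero 0<k}} p∣k) (ℕₚ.<⇒≱ k<p)
... | no  _   = refl

a-below : ∀ p n → n ℕ.< p → a p n ≡ + 1
a-below p n n<p = trans (∑-head n _) (cong₂ _+_ (cong (λ x → x * + 1 * + 1) (χ-zero p)) (∑-zero n higher))
  where
  higher : ∀ k → k ℕ.< n → χ p (suc k) * sgn (suc k) * + (n C suc k) ≡ + 0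
  higher k k<n = cong (λ x → x * sgn (suc k) * + (n C suc k)) (χ-below p (suc k) (s≤s z≤n) (ℕₚ.≤-<-trans k<n n<p))

-- Odd primes

module OddPrime (r : ℕ) (p-prime : Prime (suc (suc r))) (p-odd : ¬ 2 ∣ suc (suc r)) where

  p q : ℕ
  p = suc (suc r)
  q = suc r

  sgn-q : sgn q ≡ + 1
  sgn-q = ℤₚ.neg-injective (sgn-odd p p-odd)

  p∣pCi : ∀ i → 0 ℕ.< i → i ℕ.< p → p ∣ p C i
  p∣pCi (suc i) _ i<p with euclidsLemma (suc i) (p C suc i) p-prime
    (divides (q C i) (trans ([k+1]*[n+1]C[k+1]≡[n+1]*nCk q i) (ℕₚ.*-comm p (q C i))))
  ... | inj₁ p∣1+i = contradiction (∣⇒≤ p∣1+i) (ℕₚ.<⇒≱ i<p)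
  ... | inj₂ p∣pCi = p∣pCi

  -- (1 - x)ᵖ + xᵖ = 1 + p H(x); the division is exact for 0 < i < p and gives 0 otherwise
  H : Series
  H i = sgn i * + ((p C i) / p)

  H-zero : H 0 ≡ + 0
  H-zero = cong (λ x → + 1 * + x) (m<n⇒m/n≡0 {1} {p} (s≤s (s≤s z≤n)))

  H-vanishesAbove : VanishesAbove q H
  H-vanishesAbove i q<i = trans (cong (λ x → sgn i * + x) (m<n⇒m/n≡0 pCi<p)) (ℤₚ.*-zeroʳ (sgn i))
    where
    pCi<p : p C i ℕ.< p
    pCi<p with i ℕ.≟ p
    ... | yes refl = subst (ℕ._< p) (sym (nCn≡1 p)) (s≤s (s≤s z≤n))
    ... | no  i≢p  = subst (ℕ._< p) (sym (k>n⇒nCk≡0 (ℕₚ.≤∧≢⇒< q<i (i≢p ∘ sym)))) (s≤s z≤n)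

  p*H : ∀ i → 0 ℕ.< i → i ℕ.< p → + p * H i ≡ sgn i * + (p C i)
  p*H i 0<i i<p = begin
    + p * (sgn i * + ((p C i) / p))   ≡⟨ x∙yz≈y∙xz (+ p) (sgn i) (+ ((p C i) / p)) ⟩
    sgn i * (+ p * + ((p C i) / p))   ≡⟨ cong (sgn i *_) (ℤₚ.pos-* p ((p C i) / p)) ⟨
    sgn i * + (p ℕ.* ((p C i) / p))   ≡⟨ cong (λ x → sgn i * + x) (m*[n/m]≡n (p∣pCi i 0<i i<p)) ⟩
    sgn i * + (p C i)                 ∎
    where open ≡-Reasoning

  H-top : H q ≡ + 1
  H-top = begin
    sgn q * + ((p C q) / p)         ≡⟨ cong (λ c → sgn q * + (c / p)) (nCk≡nC[n∸k] (ℕₚ.n≤1+n q)) ⟩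
    sgn q * + ((p C (p ∸ q)) / p)   ≡⟨ cong (λ k → sgn q * + ((p C k) / p)) (ℕₚ.m+n∸n≡m 1 q) ⟩
    sgn q * + ((p C 1) / p)         ≡⟨ cong (λ c → sgn q * + (c / p)) (nC1≡n p) ⟩
    sgn q * + (p / p)               ≡⟨ cong₂ (λ s c → s * + c) sgn-q (n/n≡1 p) ⟩
    + 1                             ∎
    where open ≡-Reasoning

  A : Series
  A N = a p (suc N)

  G : Series
  G i = X^ 0 i + + p * H i

  G-below : ∀ i → i ℕ.< p → G i ≡ sgn i * + (p C i)
  G-below zero    _   = cong₂ _+_ (X^-diag 0) (trans (cong (+ p *_) H-zero) (ℤₚ.*-zeroʳ (+ p)))
  G-below (suc i) i<p = trans (cong (_+ + p * H (suc i)) (X^-off {0} {suc i} (λ ())))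
                              (trans (ℤₚ.+-identityˡ _) (p*H (suc i) (s≤s z≤n) i<p))

  G-vanishesAbove : VanishesAbove q G
  G-vanishesAbove (suc i) q<i =
    cong₂ _+_ (X^-off {0} {suc i} (λ ())) (trans (cong (+ p *_) (H-vanishesAbove (suc i) q<i)) (ℤₚ.*-zeroʳ (+ p)))

  G⊛A : ∀ N → (G ⊛ A) N ≡ A N + + p * (H ⊛ A) N
  G⊛A N = trans (⊛-distribʳ-+ (X^ 0) (λ i → + p * H i) A N) (cong₂ _+_ (X^-⊛-≤ 0 A N z≤n) (⊛-*ˡ (+ p) H A N))

  -- the sum is Δᵖ a (N′) without its last term, and both equal - a(N′)
  G⊛A-beyond : ∀ N′ → (G ⊛ A) (q ℕ.+ N′) ≡ + 0
  G⊛A-beyond N′ = begin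
    (G ⊛ A) (q ℕ.+ N′)
      ≡⟨ ∑-extend _ (s≤s (ℕₚ.m≤m+n q N′)) (λ i p≤i → cong (_* A (q ℕ.+ N′ ∸ i)) (G-vanishesAbove i p≤i)) ⟩
    ∑[ i < p ] (G i * A (q ℕ.+ N′ ∸ i))
      ≡⟨ ∑-cong p (λ i i<p → reindex i (ℕₚ.≤-pred i<p)) ⟩
    T
      ≡⟨ ∙-cancelʳ (- a p N′) T (+ 0) (begin
           T + - a p N′                                       ≡⟨ cong (_+_ T) last-term ⟨
           T + + (p C p) * (sgn p * a p (N′ ℕ.+ (p ∸ p)))     ≡⟨ Δ^p-a p p-odd N′ ⟩
           - a p N′                                           ≡⟨ ℤₚ.+-identityˡ (- a p N′) ⟨
           + 0 + - a p N′                                     ∎) ⟩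
    + 0
      ∎
    where
    open ≡-Reasoning
    T = ∑[ i < p ] (+ (p C i) * (sgn i * a p (N′ ℕ.+ (p ∸ i))))
    last-term : + (p C p) * (sgn p * a p (N′ ℕ.+ (p ∸ p))) ≡ - a p N′
    last-term rewrite nCn≡1 p | sgn-odd p p-odd | ℕₚ.n∸n≡0 p | ℕₚ.+-identityʳ N′ =
      trans (ℤₚ.*-identityˡ _) (ℤₚ.-1*i≡-i (a p N′))
    index : ∀ i → i ℕ.≤ q → suc (q ℕ.+ N′ ∸ i) ≡ N′ ℕ.+ (p ∸ i)
    index i i≤q = begin
      suc (q ℕ.+ N′ ∸ i)     ≡⟨ cong suc (ℕₚ.+-∸-comm N′ i≤q) ⟩
      suc (q ∸ i ℕ.+ N′)     ≡⟨ cong (ℕ._+ N′) (ℕₚ.+-∸-assoc 1 i≤q) ⟨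
      p ∸ i ℕ.+ N′           ≡⟨ ℕₚ.+-comm (p ∸ i) N′ ⟩
      N′ ℕ.+ (p ∸ i)         ∎
    reindex : ∀ i → i ℕ.≤ q → G i * A (q ℕ.+ N′ ∸ i) ≡ + (p C i) * (sgn i * a p (N′ ℕ.+ (p ∸ i)))
    reindex i i≤q = begin
      G i * a p (suc (q ℕ.+ N′ ∸ i))                   ≡⟨ cong₂ _*_ (G-below i (s≤s i≤q)) (cong (a p) (index i i≤q)) ⟩
      sgn i * + (p C i) * a p (N′ ℕ.+ (p ∸ i))         ≡⟨ xy∙z≈y∙xz (sgn i) (+ (p C i)) _ ⟩
      + (p C i) * (sgn i * a p (N′ ℕ.+ (p ∸ i)))       ∎

  G⊛A-below : ∀ N → N ℕ.< q → (G ⊛ A) N ≡ sgn N * + (q C N)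
  G⊛A-below N N<q = trans (∑-cong (suc N) summand) (∑-alternating-binomial q N)
    where
    summand : ∀ i → i ℕ.< suc N → G i * A (N ∸ i) ≡ sgn i * + (p C i)
    summand i i≤N = trans (cong₂ _*_ (G-below i (ℕₚ.<-trans (ℕₚ.≤-<-trans (ℕₚ.≤-pred i≤N) N<q) (ℕₚ.n<1+n q)))
                                   (a-below p (suc (N ∸ i)) (s≤s (ℕₚ.≤-<-trans (ℕₚ.m∸n≤m N i) N<q))))
                       (ℤₚ.*-identityʳ _)

  p*∂H : ∀ N → N ℕ.< q → + p * - ∂ H N ≡ + p * (sgn N * + (q C N))
  p*∂H N N<q = begin
    + p * - (+ suc N * H (suc N))                      ≡⟨ pull-p (+ p) (+ suc N) (H (suc N)) ⟩
    - (+ suc N * (+ p * H (suc N)))                    ≡⟨ cong (λ x → - (+ suc N * x)) (p*H (suc N) (s≤s z≤n) (s≤s N<q)) ⟩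
    - (+ suc N * (- sgn N * + (p C suc N)))            ≡⟨ pull-sgn (+ suc N) (sgn N) (+ (p C suc N)) ⟩
    sgn N * (+ suc N * + (p C suc N))                  ≡⟨ cong (sgn N *_) (ℤₚ.pos-* (suc N) (p C suc N)) ⟨
    sgn N * + (suc N ℕ.* (p C suc N))                  ≡⟨ cong (λ x → sgn N * + x) ([k+1]*[n+1]C[k+1]≡[n+1]*nCk q N) ⟩
    sgn N * + (p ℕ.* (q C N))                          ≡⟨ cong (sgn N *_) (ℤₚ.pos-* p (q C N)) ⟩
    sgn N * (+ p * + (q C N))                          ≡⟨ x∙yz≈y∙xz (sgn N) (+ p) (+ (q C N)) ⟩
    + p * (sgn N * + (q C N))                          ∎
    where
    open ≡-Reasoning
    pull-p : ∀ p n h → p * - (n * h) ≡ - (n * (p * h))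
    pull-p = solve-∀
    pull-sgn : ∀ n s c → - (n * (- s * c)) ≡ s * (n * c)
    pull-sgn = solve-∀

  a-recurrence : ∀ N → A N + + p * (H ⊛ A) N ≡ - ∂ H N
  a-recurrence N with q ℕ.≤? N
  ... | yes q≤N with ℕₚ.m≤n⇒∃[o]m+o≡n q≤N
  ...   | N′ , refl = begin
    A N + + p * (H ⊛ A) N       ≡⟨ G⊛A N ⟨
    (G ⊛ A) N                   ≡⟨ G⊛A-beyond N′ ⟩
    + 0                         ≡⟨ cong -_ (trans (cong (+ suc N *_) (H-vanishesAbove (suc N) (s≤s q≤N))) (ℤₚ.*-zeroʳ (+ suc N))) ⟨
    - ∂ H N                     ∎
    where open ≡-Reasoning
  a-recurrence N | no q≰N = begin
    A N + + p * (H ⊛ A) N       ≡⟨ G⊛A N ⟨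
    (G ⊛ A) N                   ≡⟨ G⊛A-below N N<q ⟩
    sgn N * + (q C N)           ≡⟨ ℤₚ.*-cancelˡ-≡ (+ p) _ _ (p*∂H N N<q) ⟨
    - ∂ H N                     ∎
    where
    open ≡-Reasoning
    N<q = ℕₚ.≰⇒> q≰N

  R : ℕ → Series
  R m = ∂ H ⊛ H ^⊛ m

  a-expansion : ∀ N → A N ≡ - ∑[ m < suc N ] ((- + p) ^ m * R m N)
  a-expansion = quotient-expansion H (+ p) A H-zero a-recurrence

  L : Series
  L i = H i - X^ q i

  H≡X^q+L : ∀ i → H i ≡ X^ q i + L i
  H≡X^q+L i = split (H i) (X^ q i)
    where
    split : ∀ x y → x ≡ y + (x - y)
    split = solve-∀

  L-vanishesAbove : VanishesAbove r L
  L-vanishesAbove i r<i with ℕₚ.m≤n⇒m<n∨m≡n r<i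
  ... | inj₁ q<i  = cong₂ _-_ (H-vanishesAbove i q<i) (X^-off (λ { refl → ℕₚ.<-irrefl refl q<i }))
  ... | inj₂ refl = cong₂ _-_ H-top (X^-diag q)

  -- n = N + 1, and e = ⌊(n - 1) / q⌋ enters only through e q ≤ N
  module _ {N e v : ℕ} (q∤n : ¬ q ∣ suc N) (e*q≤N : e ℕ.* q ℕ.≤ N) (p^v∣n : p ℕ.^ v ∣ suc N) where

    index-bound : ∀ d j → j ℕ.≤ suc (e ℕ.+ d) → suc N ℕ.≤ (suc (e ℕ.+ d) ∸ j) ℕ.* q ℕ.+ j ℕ.* r →
                  suc j ℕ.≤ suc d ℕ.* q
    index-bound d j j≤M n≤ = ℕₚ.+-cancelˡ-≤ (e ℕ.* q) (suc j) (suc d ℕ.* q) (begin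
      e ℕ.* q ℕ.+ suc j                        ≤⟨ ℕₚ.+-monoˡ-≤ (suc j) e*q≤N ⟩
      N ℕ.+ suc j                              ≡⟨ ℕₚ.+-suc N j ⟩
      suc N ℕ.+ j                              ≤⟨ ℕₚ.+-monoˡ-≤ j n≤ ⟩
      (M ∸ j) ℕ.* q ℕ.+ j ℕ.* r ℕ.+ j          ≡⟨ ℕₚ.+-assoc ((M ∸ j) ℕ.* q) (j ℕ.* r) j ⟩
      (M ∸ j) ℕ.* q ℕ.+ (j ℕ.* r ℕ.+ j)        ≡⟨ cong ((M ∸ j) ℕ.* q ℕ.+_) (trans (ℕₚ.+-comm (j ℕ.* r) j) (sym (ℕₚ.*-suc j r))) ⟩
      (M ∸ j) ℕ.* q ℕ.+ j ℕ.* q                ≡⟨ ℕₚ.*-distribʳ-+ q (M ∸ j) j ⟨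
      ((M ∸ j) ℕ.+ j) ℕ.* q                    ≡⟨ cong (ℕ._* q) (ℕₚ.m∸n+n≡m j≤M) ⟩
      M ℕ.* q                                  ≡⟨ cong (ℕ._* q) (ℕₚ.+-suc e d) ⟨
      (e ℕ.+ suc d) ℕ.* q                      ≡⟨ ℕₚ.*-distribʳ-+ q e (suc d) ⟩
      e ℕ.* q ℕ.+ suc d ℕ.* q                  ∎)
      where
      open ℕₚ.≤-Reasoning
      M = suc (e ℕ.+ d)

    H^-coefficient-divisible : ∀ d u → p ℕ.^ u ∣ suc (e ℕ.+ d) → p ℕ.^ (u ∸ d) ∣ ℤ.∣ (H ^⊛ suc (e ℕ.+ d)) (suc N) ∣
    H^-coefficient-divisible d u p^u∣M =
      subst (λ x → p ℕ.^ (u ∸ d) ∣ ℤ.∣ x ∣) (sym (^⊛-binomial q H L H≡X^q+L M n)) (∑-∣ (suc M) _ summand)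
      where
      M = suc (e ℕ.+ d)
      n = suc N
      summand : ∀ j → j ℕ.< suc M → p ℕ.^ (u ∸ d) ∣ ℤ.∣ + (M C j) * (X^ ((M ∸ j) ℕ.* q) ⊛ L ^⊛ j) n ∣
      summand zero _ = subst (λ x → p ℕ.^ (u ∸ d) ∣ ℤ.∣ x ∣) (sym (trans (ℤₚ.*-identityˡ _) first-term-vanishes)) (_ ∣0)
        where
        first-term-vanishes : (X^ (M ℕ.* q) ⊛ X^ 0) n ≡ + 0
        first-term-vanishes = trans (⊛-identityʳ (X^ (M ℕ.* q)) n) (X^-off (λ n≡Mq → q∤n (divides M n≡Mq)))
      summand (suc j) j<1+M with n ℕ.≤? (M ∸ suc j) ℕ.* q ℕ.+ suc j ℕ.* r
      ... | yes n≤ = ∣-trans (^∣-binomial p-prime d u M j p^u∣M p^[1+d]∤1+j)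
          (subst (M C suc j ∣_) (sym (ℤₚ.abs-* (+ (M C suc j)) _)) (m∣m*n _))
        where
        1+j<p^[1+d] : suc j ℕ.< p ℕ.^ suc d
        1+j<p^[1+d] = ℕₚ.≤-trans (index-bound d (suc j) (ℕₚ.≤-pred j<1+M) n≤)
          (ℕₚ.≤-trans (ℕₚ.≤-reflexive (ℕₚ.*-comm (suc d) q)) (ℕₚ.≤-trans (ℕₚ.n≤1+n _) (bernoulli q (suc d))))
        p^[1+d]∤1+j : ¬ p ℕ.^ suc d ∣ suc j
        p^[1+d]∤1+j p^[1+d]∣1+j = ℕₚ.<⇒≱ 1+j<p^[1+d] (∣⇒≤ p^[1+d]∣1+j)
      ... | no  n≰ = subst (λ x → p ℕ.^ (u ∸ d) ∣ ℤ.∣ x ∣) (sym (trans (cong (+ (M C suc j) *_) vanishes) (ℤₚ.*-zeroʳ (+ (M C suc j))))) (_ ∣0)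
        where
        t = (M ∸ suc j) ℕ.* q
        vanishes : (X^ t ⊛ L ^⊛ suc j) n ≡ + 0
        vanishes = ⊛-vanishesAbove (X^ t) (L ^⊛ suc j) (X^-vanishesAbove t)
                     (^⊛-vanishesAbove L L-vanishesAbove (suc j)) n (ℕₚ.≰⇒> n≰)

    R-divisible : ∀ d → d ℕ.< v → p ℕ.^ (v ∸ d) ∣ ℤ.∣ R (e ℕ.+ d) N ∣
    R-divisible d d<v with factor-p-power p-prime (suc (e ℕ.+ d)) (s≤s z≤n)
    ... | u , m′ , M≡p^u*m′ , p∤m′ =
      ^∣-cancel-coprime p-prime (v ∸ d) p∤m′ (*-cancelˡ-∣ (p ℕ.^ u) {{ℕₚ.m^n≢0 p u}} (begin
        p ℕ.^ u ℕ.* p ℕ.^ (v ∸ d)                      ≡⟨ ℕₚ.^-distribˡ-+-* p u (v ∸ d) ⟨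
        p ℕ.^ (u ℕ.+ (v ∸ d))                          ∣⟨ ^-monoʳ-∣ p (u+[v∸d]≤v+[u∸d] u (ℕₚ.<⇒≤ d<v)) ⟩
        p ℕ.^ (v ℕ.+ (u ∸ d))                          ≡⟨ ℕₚ.^-distribˡ-+-* p v (u ∸ d) ⟩
        p ℕ.^ v ℕ.* p ℕ.^ (u ∸ d)                      ∣⟨ *-pres-∣ p^v∣n (H^-coefficient-divisible d u p^u∣M) ⟩
        suc N ℕ.* ℤ.∣ (H ^⊛ suc (e ℕ.+ d)) (suc N) ∣   ≡⟨ ∣∂-^⊛∣ H (e ℕ.+ d) N ⟩
        suc (e ℕ.+ d) ℕ.* ∣R∣                          ≡⟨ cong (ℕ._* ∣R∣) M≡p^u*m′ ⟩
        p ℕ.^ u ℕ.* m′ ℕ.* ∣R∣                         ≡⟨ ℕₚ.*-assoc (p ℕ.^ u) m′ ∣R∣ ⟩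
        p ℕ.^ u ℕ.* (m′ ℕ.* ∣R∣)                       ∎))
      where
      open ∣-Reasoning
      ∣R∣ = ℤ.∣ R (e ℕ.+ d) N ∣
      p^u∣M : p ℕ.^ u ∣ suc (e ℕ.+ d)
      p^u∣M = divides m′ (trans M≡p^u*m′ (ℕₚ.*-comm (p ℕ.^ u) m′))

    R-vanishes : ∀ m → m ℕ.< e → R m N ≡ + 0
    R-vanishes m m<e = ℤₚ.∣i∣≡0⇒i≡0 (ℕₚ.m*n≡0⇒m≡0 _ (suc m) (begin
      ∣R∣ ℕ.* suc m                                 ≡⟨ ℕₚ.*-comm ∣R∣ (suc m) ⟩
      suc m ℕ.* ∣R∣                                 ≡⟨ ∣∂-^⊛∣ H m N ⟨
      suc N ℕ.* ℤ.∣ (H ^⊛ suc m) (suc N) ∣          ≡⟨ cong (λ x → suc N ℕ.* ℤ.∣ x ∣) H^[1+m]-vanishes ⟩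
      suc N ℕ.* 0                                   ≡⟨ ℕₚ.*-zeroʳ (suc N) ⟩
      0                                             ∎))
      where
      open ≡-Reasoning
      ∣R∣ = ℤ.∣ R m N ∣
      H^[1+m]-vanishes : (H ^⊛ suc m) (suc N) ≡ + 0
      H^[1+m]-vanishes = ^⊛-vanishesAbove H H-vanishesAbove (suc m) (suc N)
        (s≤s (ℕₚ.≤-trans (ℕₚ.*-monoˡ-≤ q m<e) e*q≤N))

    expansion-term-divisible : ∀ m → p ℕ.^ (e ℕ.+ v) ∣ ℤ.∣ (- + p) ^ m * R m N ∣
    expansion-term-divisible m rewrite ℤₚ.abs-* ((- + p) ^ m) (R m N) | ∣i^n∣≡∣i∣^n (- + p) m
      with e ℕ.+ v ℕ.≤? m | e ℕ.≤? m
    ... | yes e+v≤m | _ = ∣-trans (^-monoʳ-∣ p e+v≤m) (m∣m*n _)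
    ... | no  _     | no m≱e rewrite R-vanishes m (ℕₚ.≰⇒> m≱e) | ℕₚ.*-zeroʳ (p ℕ.^ m) = _ ∣0
    ... | no  e+v≰m | yes e≤m with ℕₚ.m≤n⇒∃[o]m+o≡n e≤m
    ...   | d , refl = subst (_∣ p ℕ.^ (e ℕ.+ d) ℕ.* _) (sym p^[e+v]≡p^[e+d]*p^[v∸d])
                             (*-monoʳ-∣ (p ℕ.^ (e ℕ.+ d)) (R-divisible d d<v))
      where
      d<v : d ℕ.< v
      d<v = ℕₚ.+-cancelˡ-< e d v (ℕₚ.≰⇒> e+v≰m)
      p^[e+v]≡p^[e+d]*p^[v∸d] : p ℕ.^ (e ℕ.+ v) ≡ p ℕ.^ (e ℕ.+ d) ℕ.* p ℕ.^ (v ∸ d)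
      p^[e+v]≡p^[e+d]*p^[v∸d] = begin
        p ℕ.^ (e ℕ.+ v)                      ≡⟨ cong (λ k → p ℕ.^ (e ℕ.+ k)) (ℕₚ.m+[n∸m]≡n (ℕₚ.<⇒≤ d<v)) ⟨
        p ℕ.^ (e ℕ.+ (d ℕ.+ (v ∸ d)))        ≡⟨ cong (p ℕ.^_) (ℕₚ.+-assoc e d (v ∸ d)) ⟨
        p ℕ.^ (e ℕ.+ d ℕ.+ (v ∸ d))          ≡⟨ ℕₚ.^-distribˡ-+-* p (e ℕ.+ d) (v ∸ d) ⟩
        p ℕ.^ (e ℕ.+ d) ℕ.* p ℕ.^ (v ∸ d)    ∎
        where open ≡-Reasoning

    p^[e+v]∣a : p ℕ.^ (e ℕ.+ v) ∣ ℤ.∣ A N ∣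
    p^[e+v]∣a = subst (λ x → p ℕ.^ (e ℕ.+ v) ∣ ℤ.∣ x ∣) (sym (a-expansion N))
      (subst (p ℕ.^ (e ℕ.+ v) ∣_) (sym (ℤₚ.∣-i∣≡∣i∣ (∑[ m < suc N ] ((- + p) ^ m * R m N))))
        (∑-∣ (suc N) _ (λ m _ → expansion-term-divisible m)))

-- Denominators of F_p(n, 0) / n

sumTo≡∑ : ∀ n f → sumTo n f ≡ ∑ (suc n) f
sumTo≡∑ zero    f = sym (ℤₚ.+-identityˡ (f 0))
sumTo≡∑ (suc n) f = cong (_+ f (suc n)) (sumTo≡∑ n f)

term-0≡ : ∀ p n k → term p n (+ 0) k ≡ χ p k * sgn k * + (n C k)
term-0≡ p n k with p ∣? ℤ.∣ + k - + 0 ∣ | p ∣? k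
... | yes _ | yes _ = trans (ℤₚ.*-comm (+ (n C k)) (sgn k)) (cong (_* + (n C k)) (sym (ℤₚ.*-identityˡ (sgn k))))
... | no  _ | no  _ = refl
... | yes p∣k+0 | no p∤k  = contradiction (subst (p ∣_) (ℕₚ.+-identityʳ k) p∣k+0) p∤k
... | no p∤k+0  | yes p∣k = contradiction (subst (p ∣_) (sym (ℕₚ.+-identityʳ k)) p∣k) p∤k+0

Cp≡a : ∀ p n → Cp p n (+ 0) ≡ a p n
Cp≡a p n = trans (sumTo≡∑ n (term p n (+ 0))) (∑-cong (suc n) (λ k _ → term-0≡ p n k))

Fp-unfold : ∀ r m → ∃ λ k → suc (suc r) ℕ.^ (m / suc r) ≡ suc k ×
  Fp (suc (suc r)) (suc m) (+ 0) ≡ (sgn (m / suc r) * Cp (suc (suc r)) (suc m) (+ 0)) ℚ./ suc k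
Fp-unfold r m with suc (suc r) ℕ.^ (m / suc r) in p^e≡
... | zero  = contradiction (ℕₚ.m^n≡0⇒m≡0 (suc (suc r)) (m / suc r) p^e≡) λ ()
... | suc k = k , refl , refl

↧ₙ-/-∣ : ∀ i n .{{_ : NonZero n}} → ↧ₙ (i ℚ./ n) ∣ n
↧ₙ-/-∣ i n = divides ℤ.∣ gcd i (+ n) ∣ (begin
  n                                         ≡⟨ cong ℤ.∣_∣ (ℚₚ.↧-/ i n) ⟨
  ℤ.∣ ↧ (i ℚ./ n) * gcd i (+ n) ∣           ≡⟨ ℤₚ.abs-* (↧ (i ℚ./ n)) (gcd i (+ n)) ⟩
  ↧ₙ (i ℚ./ n) ℕ.* ℤ.∣ gcd i (+ n) ∣        ≡⟨ ℕₚ.*-comm (↧ₙ (i ℚ./ n)) _ ⟩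
  ℤ.∣ gcd i (+ n) ∣ ℕ.* ↧ₙ (i ℚ./ n)        ∎)
  where open ≡-Reasoning

toℚᵘ-/ : ∀ i n .{{_ : NonZero n}} → toℚᵘ (i ℚ./ n) ℚᵘ.≃ (i ℚᵘ./ n)
toℚᵘ-/ i n = cross-multiply (i ℚ./ n) (ℚₚ.↥-/ i n) (ℚₚ.↧-/ i n)
  where
  g = gcd i (+ n)
  cross-multiply : ∀ x → ↥ x * g ≡ i → ↧ x * g ≡ + n → toℚᵘ x ℚᵘ.≃ (i ℚᵘ./ n)
  cross-multiply x@(ℚ.mkℚ _ _ _) ↥x*g≡i ↧x*g≡n = ℚᵘ.*≡* (begin
    ↥ x * ℚᵘ.↧ (i ℚᵘ./ n)   ≡⟨ cong (↥ x *_) (ℚᵘₚ.↧[n/d]≡d i n) ⟩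
    ↥ x * + n               ≡⟨ cong (↥ x *_) ↧x*g≡n ⟨
    ↥ x * (↧ x * g)         ≡⟨ x∙yz≈xz∙y (↥ x) (↧ x) g ⟩
    ↥ x * g * ↧ x           ≡⟨ cong (_* ↧ x) ↥x*g≡i ⟩
    i * ↧ x                 ≡⟨ cong (_* ↧ x) (ℚᵘₚ.↥[n/d]≡n i n) ⟨
    ℚᵘ.↥ (i ℚᵘ./ n) * ↧ x   ∎)
    where open ≡-Reasoning

/-*-1/ : ∀ i j b n w → i * + suc w ≡ j * (+ suc b * + suc n) →
  (i ℚ./ suc b) ℚ.* (+ 1 ℚ./ suc n) ≡ j ℚ./ suc w
/-*-1/ i j b n w i*w≡j*b*n = ℚₚ.toℚᵘ-injective (begin
  toℚᵘ ((i ℚ./ suc b) ℚ.* (+ 1 ℚ./ suc n))       ≈⟨ ℚₚ.toℚᵘ-homo-* (i ℚ./ suc b) (+ 1 ℚ./ suc n) ⟩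
  toℚᵘ (i ℚ./ suc b) ℚᵘ.* toℚᵘ (+ 1 ℚ./ suc n)   ≈⟨ ℚᵘₚ.*-cong (toℚᵘ-/ i (suc b)) (toℚᵘ-/ (+ 1) (suc n)) ⟩
  (i ℚᵘ./ suc b) ℚᵘ.* (+ 1 ℚᵘ./ suc n)           ≈⟨ ℚᵘ.*≡* cross ⟩
  j ℚᵘ./ suc w                                   ≈⟨ ℚᵘₚ.≃-sym (toℚᵘ-/ j (suc w)) ⟩
  toℚᵘ (j ℚ./ suc w)                             ∎)
  where
  open ℚᵘₚ.≃-Reasoning
  cross : i * + 1 * + suc w ≡ j * + (suc b ℕ.* suc n)
  cross = trans (cong (_* + suc w) (ℤₚ.*-identityʳ i)) (trans i*w≡j*b*n (cong (j *_) (sym (ℤₚ.pos-* (suc b) (suc n)))))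

InZp-/ : ∀ p j w → ¬ p ∣ suc w → InZp p (j ℚ./ suc w)
InZp-/ p j w p∤w p∣↧ = p∤w (∣-trans p∣↧ (↧ₙ-/-∣ j (suc w)))

InZp-Fp/n : ∀ r m v w c → let p = suc (suc r) in
  suc m ≡ p ℕ.^ v ℕ.* suc w → ¬ p ∣ suc w → a p (suc m) ≡ c * + (p ℕ.^ (m / suc r ℕ.+ v)) →
  InZp p (divBy (Fp p (suc m) (+ 0)) (suc m))
InZp-Fp/n r m v w c n≡p^v*w p∤w a≡cP with Fp-unfold r m
... | k , p^e≡1+k , Fp≡ = subst (InZp p) (sym Fp/n≡c/w) (InZp-/ p (sgn e * c) w p∤w)
  where
  p = suc (suc r)
  e = m / suc r
  P = p ℕ.^ (e ℕ.+ v)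
  P*w≡[1+k]*n : P ℕ.* suc w ≡ suc k ℕ.* suc m
  P*w≡[1+k]*n = begin
    P ℕ.* suc w                        ≡⟨ cong (ℕ._* suc w) (ℕₚ.^-distribˡ-+-* p e v) ⟩
    p ℕ.^ e ℕ.* p ℕ.^ v ℕ.* suc w      ≡⟨ ℕₚ.*-assoc (p ℕ.^ e) (p ℕ.^ v) (suc w) ⟩
    p ℕ.^ e ℕ.* (p ℕ.^ v ℕ.* suc w)    ≡⟨ cong₂ ℕ._*_ p^e≡1+k (sym n≡p^v*w) ⟩
    suc k ℕ.* suc m                    ∎
    where open ≡-Reasoning
  reassoc : ∀ s c P w → s * (c * P) * w ≡ s * c * (P * w)
  reassoc = solve-∀
  cross : sgn e * Cp p (suc m) (+ 0) * + suc w ≡ sgn e * c * (+ suc k * + suc m)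
  cross = begin
    sgn e * Cp p (suc m) (+ 0) * + suc w   ≡⟨ cong (λ x → sgn e * x * + suc w) (trans (Cp≡a p (suc m)) a≡cP) ⟩
    sgn e * (c * + P) * + suc w            ≡⟨ reassoc (sgn e) c (+ P) (+ suc w) ⟩
    sgn e * c * (+ P * + suc w)            ≡⟨ cong (sgn e * c *_) (ℤₚ.pos-* P (suc w)) ⟨
    sgn e * c * + (P ℕ.* suc w)            ≡⟨ cong (λ x → sgn e * c * + x) P*w≡[1+k]*n ⟩
    sgn e * c * + (suc k ℕ.* suc m)        ≡⟨ cong (sgn e * c *_) (ℤₚ.pos-* (suc k) (suc m)) ⟩
    sgn e * c * (+ suc k * + suc m)        ∎
    where open ≡-Reasoning
  Fp/n≡c/w : divBy (Fp p (suc m) (+ 0)) (suc m) ≡ (sgn e * c) ℚ./ suc w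
  Fp/n≡c/w = trans (cong (ℚ._* (+ 1 ℚ./ suc m)) Fp≡) (/-*-1/ (sgn e * Cp p (suc m) (+ 0)) (sgn e * c) k m w cross)

lemma1p1 : (p : ℕ) → Prime p → ¬ (2 ∣ p) →
    (n : ℕ) → .{{_ : NonZero n}} → ¬ ((p ∸ 1) ∣ n) →
    InZp p (divBy (Fp p n (+ 0)) n)
lemma1p1 zero          p-prime _ _ _ = contradiction (p≥2 p-prime) λ ()
lemma1p1 (suc zero)    p-prime _ _ _ = contradiction (p≥2 p-prime) λ { (s≤s ()) }
lemma1p1 (suc (suc r)) _ _ zero {{n≢0}} _ = contradiction refl (ℕ.≢-nonZero⁻¹ 0 {{n≢0}})
lemma1p1 (suc (suc r)) p-prime p-odd (suc m) q∤n with factor-p-power p-prime (suc m) (s≤s z≤n)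
... | v , zero , n≡p^v*0 , _ = contradiction (trans n≡p^v*0 (ℕₚ.*-zeroʳ (suc (suc r) ℕ.^ v))) λ ()
... | v , suc w , n≡p^v*w , p∤w = InZp-Fp/n r m v w (ℤ∣._∣_.quotient p^[e+v]∣a) n≡p^v*w p∤w (ℤ∣._∣_.equality p^[e+v]∣a)
  where
  p = suc (suc r)
  e = m / suc r
  p^[e+v]∣a : (+ (p ℕ.^ (e ℕ.+ v))) ℤ∣.∣ a p (suc m)
  p^[e+v]∣a = ℤ∣.∣ᵤ⇒∣ (OddPrime.p^[e+v]∣a r p-prime p-odd {m} {e} {v} q∤n (m/n*n≤m m (suc r))
                         (divides (suc w) (trans n≡p^v*w (ℕₚ.*-comm (p ℕ.^ v) (suc w)))))
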